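{- Let $G$ be a matching covered graph with a vertex $v_0$ of degree two whose two neighbours $v_1,v_2$ are distinct, and let $H$ be the graph obtained from $G$ by contracting the edges $v_0v_1$ and $v_0v_2$. Then $G$ is $\theta$-free if and only if $H$ is $\theta$-free.
   Context: Graphs loopless; multiple edges allowed (contraction may create parallel edges). A connected graph with at least two vertices is matching covered if every edge lies in a perfect matching. $\theta$ is two vertices joined by three parallel edges. A subgraph $H'$ of a graph $G'$ is conformal if $G'-V(H')$ has a perfect matching; a matching covered graph is $\theta$-free if it has no conformal subgraph that is a bisubdivision of $\theta$ (obtained by replacing some edges of $\theta$ by paths with an even number of internal vertices). -}

module Defs where

open import Data.Nat using (ℕ; zero; suc; _+_; _≤_)
open import Data.Fin using (Fin; zero; suc; inject₁; fromℕ)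
open import Data.Product using (Σ; ∃; _×_; _,_)
open import Data.Sum using (_⊎_)
open import Data.Bool using (Bool; true)
open import Data.Empty using (⊥)
open import Relation.Nullary using (¬_)
open import Relation.Binary.PropositionalEquality using (_≡_; _≢_)
open import Function.Definitions using (Injective)

-- A finite loopless multigraph: vertices Fin nV, edges Fin nE,
-- each edge has two (distinct) ends. Parallel edges are allowed.
record Graph : Set where
  field
    nV nE    : ℕ
    src tgt  : Fin nE → Fin nV
    loopless : ∀ e → src e ≢ tgt e

open Graph public

V : Graph → Set
V G = Fin (nV G)

E : Graph → Set
E G = Fin (nE G)

Inc : (G : Graph) → E G → V G → Set
Inc G e v = src G e ≡ v ⊎ tgt G e ≡ v

Joins : (G : Graph) → E G → V G → V G → Set
Joins G e u w = (src G e ≡ u × tgt G e ≡ w) ⊎ (src G e ≡ w × tgt G e ≡ u)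

-- A perfect matching of G - S, where S is a set of vertices (as a predicate):
-- a set M of edges of G - S covering every vertex of G - S exactly once.
record PerfectMatchingAvoiding (G : Graph) (S : V G → Set) : Set where
  field
    M      : E G → Bool
    avoid  : ∀ e → M e ≡ true → ¬ S (src G e) × ¬ S (tgt G e)
    cover  : ∀ v → ¬ S v → ∃ λ e → M e ≡ true × Inc G e v
    unique : ∀ v e e′ → M e ≡ true → M e′ ≡ true → Inc G e v → Inc G e′ v → e ≡ e′

PerfectMatching : Graph → Set
PerfectMatching G = PerfectMatchingAvoiding G (λ _ → ⊥)

data Walk (G : Graph) : V G → V G → Set where
  []   : ∀ {v} → Walk G v v
  step : ∀ {u w x} (e : E G) → Joins G e u w → Walk G w x → Walk G u x

Connected : Graph → Set
Connected G = ∀ u w → Walk G u w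

MatchingCovered : Graph → Set
MatchingCovered G =
  2 ≤ nV G × Connected G ×
  (∀ e → Σ (PerfectMatching G) λ P → PerfectMatchingAvoiding.M P e ≡ true)

record Path (G : Graph) (a b : V G) : Set where
  field
    len      : ℕ
    vert     : Fin (suc len) → V G
    vert-inj : Injective _≡_ _≡_ vert
    edge     : Fin len → E G
    start    : vert zero ≡ a
    end      : vert (fromℕ len) ≡ b
    link     : ∀ i → Joins G (edge i) (vert (inject₁ i)) (vert (suc i))

module _ {G : Graph} {a b : V G} where
  OnPath : Path G a b → V G → Set
  OnPath P v = ∃ λ i → Path.vert P i ≡ v

  EdgeOnPath : Path G a b → E G → Set
  EdgeOnPath P e = ∃ λ i → Path.edge P i ≡ e

  Internal : Path G a b → V G → Set
  Internal P v = OnPath P v × v ≢ a × v ≢ b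

  -- even number of internal vertices (i.e. odd length)
  EvenInternal : Path G a b → Set
  EvenInternal P = ∃ λ k → Path.len P ≡ suc (k + k)

  InternallyDisjoint : Path G a b → Path G a b → Set
  InternallyDisjoint P Q =
    (∀ v → Internal P v → ¬ OnPath Q v) × (∀ e → EdgeOnPath P e → ¬ EdgeOnPath Q e)

-- A conformal subgraph of G that is a bisubdivision of θ: the union H′ of
-- three internally disjoint a–b paths, each with an even number of internal
-- vertices, such that G - V(H′) has a perfect matching.
record ConformalBiTheta (G : Graph) : Set where
  field
    a b   : V G
    a≢b   : a ≢ b
    P₁ P₂ P₃ : Path G a b
    even₁ : EvenInternal P₁
    even₂ : EvenInternal P₂
    even₃ : EvenInternal P₃
    disj₁₂ : InternallyDisjoint P₁ P₂
    disj₁₃ : InternallyDisjoint P₁ P₃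
    disj₂₃ : InternallyDisjoint P₂ P₃
    conformal : PerfectMatchingAvoiding G
                  (λ v → OnPath P₁ v ⊎ OnPath P₂ v ⊎ OnPath P₃ v)

ThetaFree : Graph → Set
ThetaFree G = ¬ ConformalBiTheta G

DegreeTwo : (G : Graph) (v₀ v₁ v₂ : V G) (e₁ e₂ : E G) → Set
DegreeTwo G v₀ v₁ v₂ e₁ e₂ =
  e₁ ≢ e₂ × Joins G e₁ v₀ v₁ × Joins G e₂ v₀ v₂ ×
  (∀ e → Inc G e v₀ → e ≡ e₁ ⊎ e ≡ e₂)

-- H is (up to isomorphism) the graph obtained from G by contracting e₁ and e₂:
-- f identifies exactly v₀, v₁, v₂ and is otherwise bijective on vertices;
-- g is a bijection from E(H) onto E(G) ∖ {e₁, e₂} preserving ends via f.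
record Contraction (G : Graph) (v₀ v₁ v₂ : V G) (e₁ e₂ : E G) (H : Graph) : Set where
  field
    f       : V G → V H
    f-surj  : ∀ w → ∃ λ v → f v ≡ w
    f-v₁    : f v₀ ≡ f v₁
    f-v₂    : f v₀ ≡ f v₂
    f-inj   : ∀ x y → f x ≡ f y →
              x ≡ y ⊎ ((x ≡ v₀ ⊎ x ≡ v₁ ⊎ x ≡ v₂) × (y ≡ v₀ ⊎ y ≡ v₁ ⊎ y ≡ v₂))
    g       : E H → E G
    g-inj   : Injective _≡_ _≡_ g
    g-avoid : ∀ e′ → g e′ ≢ e₁ × g e′ ≢ e₂
    g-surj  : ∀ e → e ≢ e₁ → e ≢ e₂ → ∃ λ e′ → g e′ ≡ e
    g-ends  : ∀ e′ → Joins H e′ (f (src G (g e′))) (f (tgt G (g e′)))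

{-# OPTIONS --safe #-}
-- Contracting v₁ v₀ v₂ to a vertex c carries conformal bisubdivisions of θ back and forth.
-- Since v₀ has degree two it is never a branch vertex of a theta of G.  If it lies inside a path,
-- that path runs v₁ v₀ v₂ and contracting e₁, e₂ shortens it by two; if it lies on no path, the
-- perfect matching of the rest covers it by e₁ or e₂ and, without that edge, becomes a perfect
-- matching of the rest of H.  Conversely, a theta of H is lifted path by path: a path through c,
-- or leaving the branch vertex c, either continues at the same vertex v₁ or v₂, or crosses from v₁
-- to v₂ by the detour e₁ e₂, which keeps the parity of its length; when v₀ and v₂ are left
-- uncovered the lifted matching is completed by e₂.  The symmetry v₁ ↔ v₂ halves the cases.
module Submission where

open import Defs
open import Data.Nat using (ℕ; zero; suc; _+_)
open import Data.Nat.Properties using (+-suc; suc-injective)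
open import Data.Fin using (Fin; zero; suc; inject₁; fromℕ; _≟_)
import Data.Fin.Properties as Fin
open import Data.List using (List; []; _∷_; _++_; length; map; reverse)
open import Data.List.Properties using (length-++; length-map; map-++; ++-assoc; unfold-reverse; length-reverse)
open import Data.List.Membership.Propositional using (_∈_; _∉_)
open import Data.List.Membership.Propositional.Properties using (∈-++⁺ˡ; ∈-++⁺ʳ; ∈-++⁻; ∈-map⁺; ∈-map⁻)
open import Data.List.Relation.Unary.Any using (here; there; any?)
open import Data.List.Relation.Unary.Any.Properties using (reverse⁺; reverse⁻)
open import Data.Product using (Σ; ∃; ∃₂; _×_; _,_; proj₁; proj₂)
import Data.Product as Product
open import Data.Sum using (_⊎_; inj₁; inj₂; swap) renaming (map to ⊎-map)
open import Data.Empty using (⊥; ⊥-elim)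
open import Data.Unit using (⊤; tt)
open import Data.Bool using (Bool; true; false)
open import Relation.Nullary using (¬_; Dec; yes; no)
open import Relation.Nullary.Decidable using (_⊎-dec_)
open import Relation.Binary.PropositionalEquality
open import Function.Base using (id)
open import Function.Definitions using (Injective)
open import Function.Bundles using (_⇔_; mk⇔)

-- Data.List.Relation.Unary.Unique in the x ∉ xs form, which the walk surgery below splits along _++_.
Distinct : {A : Set} → List A → Set
Distinct []       = ⊤
Distinct (x ∷ xs) = x ∉ xs × Distinct xs

module _ {A : Set} where

  distinct-++⁻ : (xs ys : List A) → Distinct (xs ++ ys) →
                 Distinct xs × Distinct ys × (∀ {x} → x ∈ xs → x ∉ ys)
  distinct-++⁻ []       ys d        = tt , d , λ ()
  distinct-++⁻ (x ∷ xs) ys (x∉ , d) with distinct-++⁻ xs ys d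
  ... | dxs , dys , apart = ((λ m → x∉ (∈-++⁺ˡ m)) , dxs) , dys , apart′
    where
    apart′ : ∀ {z} → z ∈ x ∷ xs → z ∉ ys
    apart′ (here refl) m = x∉ (∈-++⁺ʳ xs m)
    apart′ (there p)   m = apart p m

  distinct-++⁺ : (xs ys : List A) → Distinct xs → Distinct ys →
                 (∀ {x} → x ∈ xs → x ∉ ys) → Distinct (xs ++ ys)
  distinct-++⁺ []       ys _          dys _     = dys
  distinct-++⁺ (x ∷ xs) ys (x∉ , dxs) dys apart =
    x∉xs++ys , distinct-++⁺ xs ys dxs dys (λ m → apart (there m))
    where
    x∉xs++ys : x ∉ xs ++ ys
    x∉xs++ys m with ∈-++⁻ xs m
    ... | inj₁ p = x∉ p
    ... | inj₂ p = apart (here refl) p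

  distinct-insert : (xs zs ys : List A) → Distinct (xs ++ ys) → Distinct zs →
                    (∀ {z} → z ∈ zs → z ∉ xs ++ ys) → Distinct (xs ++ zs ++ ys)
  distinct-insert xs zs ys d dzs new with distinct-++⁻ xs ys d
  ... | dxs , dys , apart =
    distinct-++⁺ xs (zs ++ ys) dxs
      (distinct-++⁺ zs ys dzs dys (λ z∈ z∈ys → new z∈ (∈-++⁺ʳ xs z∈ys))) apart′
    where
    apart′ : ∀ {z} → z ∈ xs → z ∉ zs ++ ys
    apart′ z∈xs z∈ with ∈-++⁻ zs z∈
    ... | inj₁ z∈zs = new z∈zs (∈-++⁺ˡ z∈xs)
    ... | inj₂ z∈ys = apart z∈xs z∈ys

  distinct-map⁺ : {B : Set} (f : A → B) (xs : List A) → Distinct xs →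
    (∀ {x y} → x ∈ xs → y ∈ xs → f x ≡ f y → x ≡ y) → Distinct (map f xs)
  distinct-map⁺ f []       _          _   = tt
  distinct-map⁺ f (x ∷ xs) (x∉ , dxs) inj =
    fx∉ , distinct-map⁺ f xs dxs (λ p q → inj (there p) (there q))
    where
    fx∉ : f x ∉ map f xs
    fx∉ m with ∈-map⁻ f m
    ... | y , y∈ , fx≡fy with inj (here refl) (there y∈) fx≡fy
    ... | refl = x∉ y∈

  distinct-reverse⁺ : (xs : List A) → Distinct xs → Distinct (reverse xs)
  distinct-reverse⁺ []       _          = tt
  distinct-reverse⁺ (x ∷ xs) (x∉ , dxs) rewrite unfold-reverse x xs =
    distinct-++⁺ (reverse xs) (x ∷ []) (distinct-reverse⁺ xs dxs) ((λ ()) , tt) apart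
    where
    apart : ∀ {z} → z ∈ reverse xs → z ∉ x ∷ []
    apart m (here refl) = x∉ (reverse⁻ m)

Odd : ℕ → Set
Odd n = ∃ λ k → n ≡ suc (k + k)

odd-suc-suc⁻ : ∀ n → Odd (suc (suc n)) → Odd n
odd-suc-suc⁻ n (zero  , ())
odd-suc-suc⁻ n (suc k , eq) = k , trans (suc-injective (suc-injective eq)) (+-suc k k)

odd-suc-suc⁺ : ∀ n → Odd n → Odd (suc (suc n))
odd-suc-suc⁺ n (k , eq) = suc k , cong suc (trans (cong suc eq) (cong suc (sym (+-suc k k))))

+-suc-suc : ∀ m n → m + suc (suc n) ≡ suc (suc (m + n))
+-suc-suc m n = trans (+-suc m (suc n)) (cong suc (+-suc m n))

pigeonhole : ∀ {A : Set} {p q x y z : A} → x ≡ p ⊎ x ≡ q → y ≡ p ⊎ y ≡ q → z ≡ p ⊎ z ≡ q →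
             x ≡ y ⊎ x ≡ z ⊎ y ≡ z
pigeonhole (inj₁ refl) (inj₁ refl) _           = inj₁ refl
pigeonhole (inj₂ refl) (inj₂ refl) _           = inj₁ refl
pigeonhole (inj₁ refl) (inj₂ refl) (inj₁ refl) = inj₂ (inj₁ refl)
pigeonhole (inj₁ refl) (inj₂ refl) (inj₂ refl) = inj₂ (inj₂ refl)
pigeonhole (inj₂ refl) (inj₁ refl) (inj₁ refl) = inj₂ (inj₂ refl)
pigeonhole (inj₂ refl) (inj₁ refl) (inj₂ refl) = inj₂ (inj₁ refl)

module Ends (G : Graph) where

  joins-sym : ∀ {e u w} → Joins G e u w → Joins G e w u
  joins-sym (inj₁ pq) = inj₂ pq
  joins-sym (inj₂ pq) = inj₁ pq

  joins⇒inc₁ : ∀ {e u w} → Joins G e u w → Inc G e u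
  joins⇒inc₁ (inj₁ (p , q)) = inj₁ p
  joins⇒inc₁ (inj₂ (p , q)) = inj₂ q

  joins⇒inc₂ : ∀ {e u w} → Joins G e u w → Inc G e w
  joins⇒inc₂ j = joins⇒inc₁ (joins-sym j)

  inc-joins : ∀ {e u w x} → Joins G e u w → Inc G e x → x ≡ u ⊎ x ≡ w
  inc-joins (inj₁ (p , q)) (inj₁ r) = inj₁ (trans (sym r) p)
  inc-joins (inj₁ (p , q)) (inj₂ r) = inj₂ (trans (sym r) q)
  inc-joins (inj₂ (p , q)) (inj₁ r) = inj₂ (trans (sym r) p)
  inc-joins (inj₂ (p , q)) (inj₂ r) = inj₁ (trans (sym r) q)

  joins-unique : ∀ {e p q r s} → Joins G e p q → Joins G e r s →
                 (p ≡ r × q ≡ s) ⊎ (p ≡ s × q ≡ r)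
  joins-unique (inj₁ (a , b)) (inj₁ (c , d)) = inj₁ (trans (sym a) c , trans (sym b) d)
  joins-unique (inj₁ (a , b)) (inj₂ (c , d)) = inj₂ (trans (sym a) c , trans (sym b) d)
  joins-unique (inj₂ (a , b)) (inj₁ (c , d)) = inj₂ (trans (sym b) d , trans (sym a) c)
  joins-unique (inj₂ (a , b)) (inj₂ (c , d)) = inj₁ (trans (sym b) d , trans (sym a) c)

  joins-irrefl : ∀ {e u} → ¬ Joins G e u u
  joins-irrefl {e} (inj₁ (p , q)) = loopless G e (trans p (sym q))
  joins-irrefl {e} (inj₂ (p , q)) = loopless G e (trans p (sym q))

  joins⇒≢ : ∀ {e u w} → Joins G e u w → u ≢ w
  joins⇒≢ j refl = joins-irrefl j

  joins-other-end : ∀ {e p x q} → Joins G e p x → Joins G e x q → p ≡ q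
  joins-other-end j k with joins-unique j k
  ... | inj₁ (p≡x , _) = ⊥-elim (joins-irrefl (subst (λ z → Joins G _ z _) p≡x j))
  ... | inj₂ (p≡q , _) = p≡q

matching-cong : ∀ {G : Graph} {S S′ : V G → Set} → (∀ v → S v → S′ v) → (∀ v → S′ v → S v) →
                PerfectMatchingAvoiding G S → PerfectMatchingAvoiding G S′
matching-cong to from P = record
  { M      = M
  ; avoid  = λ e m → (λ s → proj₁ (avoid e m) (from _ s)) , (λ s → proj₂ (avoid e m) (from _ s))
  ; cover  = λ v ¬s → cover v (λ s → ¬s (to v s))
  ; unique = unique }
  where open PerfectMatchingAvoiding P

module _ {G : Graph} where
  open Ends G

  vertices : ∀ {u w} → Walk G u w → List (V G)
  vertices {u} []           = u ∷ []
  vertices {u} (step e j W) = u ∷ vertices W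

  frontVertices : ∀ {u w} → Walk G u w → List (V G)
  frontVertices     []           = []
  frontVertices {u} (step e j W) = u ∷ frontVertices W

  edges : ∀ {u w} → Walk G u w → List (E G)
  edges []           = []
  edges (step e j W) = e ∷ edges W

  walkLength : ∀ {u w} → Walk G u w → ℕ
  walkLength W = length (edges W)

  infixr 5 _++ʷ_
  _++ʷ_ : ∀ {u w x} → Walk G u w → Walk G w x → Walk G u x
  []           ++ʷ B = B
  step e j A   ++ʷ B = step e j (A ++ʷ B)

  vertices-++ : ∀ {u w x} (A : Walk G u w) (B : Walk G w x) →
                vertices (A ++ʷ B) ≡ frontVertices A ++ vertices B
  vertices-++     []           B = refl
  vertices-++ {u} (step e j A) B = cong (u ∷_) (vertices-++ A B)

  edges-++ : ∀ {u w x} (A : Walk G u w) (B : Walk G w x) → edges (A ++ʷ B) ≡ edges A ++ edges B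
  edges-++ []           B = refl
  edges-++ (step e j A) B = cong (e ∷_) (edges-++ A B)

  vertices-front : ∀ {u w} (A : Walk G u w) → vertices A ≡ frontVertices A ++ w ∷ []
  vertices-front     []           = refl
  vertices-front {u} (step e j A) = cong (u ∷_) (vertices-front A)

  cast : ∀ {u u′ w w′} → u ≡ u′ → w ≡ w′ → Walk G u w → Walk G u′ w′
  cast refl refl W = W

  vertices-cast : ∀ {u u′ w w′} (p : u ≡ u′) (q : w ≡ w′) (W : Walk G u w) →
                  vertices (cast p q W) ≡ vertices W
  vertices-cast refl refl W = refl

  edges-cast : ∀ {u u′ w w′} (p : u ≡ u′) (q : w ≡ w′) (W : Walk G u w) →
               edges (cast p q W) ≡ edges W
  edges-cast refl refl W = refl

  start∈ : ∀ {u w} (W : Walk G u w) → u ∈ vertices W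
  start∈ []           = here refl
  start∈ (step e j W) = here refl

  end∈ : ∀ {u w} (W : Walk G u w) → w ∈ vertices W
  end∈ []           = here refl
  end∈ (step e j W) = there (end∈ W)

  inc∈vertices : ∀ {u w e x} (W : Walk G u w) → e ∈ edges W → Inc G e x → x ∈ vertices W
  inc∈vertices (step e j W) (here refl) i with inc-joins j i
  ... | inj₁ refl = here refl
  ... | inj₂ refl = there (start∈ W)
  inc∈vertices (step e j W) (there m) i = there (inc∈vertices W m i)

  first-edge : ∀ {u w} (W : Walk G u w) → u ≢ w → ∃ λ e → e ∈ edges W × Inc G e u
  first-edge []           u≢w = ⊥-elim (u≢w refl)
  first-edge (step e j W) _   = e , here refl , joins⇒inc₁ j

  last-edge : ∀ {u w} (W : Walk G u w) → u ≢ w → ∃ λ e → e ∈ edges W × Inc G e w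
  last-edge []           u≢w = ⊥-elim (u≢w refl)
  last-edge (step e j W) _   = last-of-step e j W
    where
    last-of-step : ∀ {u v w} e (j : Joins G e u v) (W : Walk G v w) →
                   ∃ λ x → x ∈ edges (step e j W) × Inc G x w
    last-of-step e j []             = e , here refl , joins⇒inc₂ j
    last-of-step e j (step e′ j′ W) with last-of-step e′ j′ W
    ... | x , m , i = x , there m , i

  closed-distinct⇒length0 : ∀ {u w} (W : Walk G u w) → u ≡ w → Distinct (vertices W) →
                            walkLength W ≡ 0
  closed-distinct⇒length0 []           _    _        = refl
  closed-distinct⇒length0 (step e j W) refl (u∉ , _) = ⊥-elim (u∉ (end∈ W))

  reverseʷ : ∀ {u w} → Walk G u w → Walk G w u
  reverseʷ []           = []
  reverseʷ (step e j W) = reverseʷ W ++ʷ step e (joins-sym j) []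

  vertices-reverse : ∀ {u w} (W : Walk G u w) → vertices (reverseʷ W) ≡ reverse (vertices W)
  vertices-reverse [] = refl
  vertices-reverse {u} (step {w = w} e j W) = begin
      vertices (reverseʷ W ++ʷ step e (joins-sym j) [])
    ≡⟨ vertices-++ (reverseʷ W) _ ⟩
      frontVertices (reverseʷ W) ++ w ∷ u ∷ []
    ≡⟨ ++-assoc (frontVertices (reverseʷ W)) (w ∷ []) (u ∷ []) ⟨
      (frontVertices (reverseʷ W) ++ w ∷ []) ++ u ∷ []
    ≡⟨ cong (_++ u ∷ []) (vertices-front (reverseʷ W)) ⟨
      vertices (reverseʷ W) ++ u ∷ []
    ≡⟨ cong (_++ u ∷ []) (vertices-reverse W) ⟩
      reverse (vertices W) ++ u ∷ []
    ≡⟨ unfold-reverse u (vertices W) ⟨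
      reverse (u ∷ vertices W) ∎
    where open ≡-Reasoning

  edges-reverse : ∀ {u w} (W : Walk G u w) → edges (reverseʷ W) ≡ reverse (edges W)
  edges-reverse []           = refl
  edges-reverse (step e j W) = begin
      edges (reverseʷ W ++ʷ step e (joins-sym j) [])
    ≡⟨ edges-++ (reverseʷ W) _ ⟩
      edges (reverseʷ W) ++ e ∷ []
    ≡⟨ cong (_++ e ∷ []) (edges-reverse W) ⟩
      reverse (edges W) ++ e ∷ []
    ≡⟨ unfold-reverse e (edges W) ⟨
      reverse (e ∷ edges W) ∎
    where open ≡-Reasoning

  walkLength-reverse : ∀ {u w} (W : Walk G u w) → walkLength (reverseʷ W) ≡ walkLength W
  walkLength-reverse W = trans (cong length (edges-reverse W)) (length-reverse (edges W))

  ∈vertices-reverse⁻ : ∀ {u w v} (W : Walk G u w) → v ∈ vertices (reverseʷ W) → v ∈ vertices W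
  ∈vertices-reverse⁻ W m = reverse⁻ (subst (_ ∈_) (vertices-reverse W) m)

  ∈vertices-reverse⁺ : ∀ {u w v} (W : Walk G u w) → v ∈ vertices W → v ∈ vertices (reverseʷ W)
  ∈vertices-reverse⁺ W m = subst (_ ∈_) (sym (vertices-reverse W)) (reverse⁺ m)

  ∈edges-reverse⁻ : ∀ {u w x} (W : Walk G u w) → x ∈ edges (reverseʷ W) → x ∈ edges W
  ∈edges-reverse⁻ W m = reverse⁻ (subst (_ ∈_) (edges-reverse W) m)

  distinct-reverseʷ : ∀ {u w} (W : Walk G u w) → Distinct (vertices W) →
                      Distinct (vertices (reverseʷ W))
  distinct-reverseʷ W d = subst Distinct (sym (vertices-reverse W)) (distinct-reverse⁺ (vertices W) d)

  record SplitAt {u w : V G} (W : Walk G u w) (x : V G) : Set where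
    field
      p s      : V G
      e⁻ e⁺    : E G
      joins⁻   : Joins G e⁻ p x
      joins⁺   : Joins G e⁺ x s
      A        : Walk G u p
      B        : Walk G s w
      vertices-split : vertices W ≡ frontVertices A ++ p ∷ x ∷ vertices B
      edges-split    : edges W ≡ edges A ++ e⁻ ∷ e⁺ ∷ edges B

  splitAt : ∀ {u w} (x : V G) (W : Walk G u w) → x ∈ vertices W → x ≢ u → x ≢ w → SplitAt W x
  splitAt x []           (here refl) x≢u _   = ⊥-elim (x≢u refl)
  splitAt x (step e j W) (here refl) x≢u _   = ⊥-elim (x≢u refl)
  splitAt x (step {w = w′} e j W) (there m) x≢u x≢w with x ≟ w′
  splitAt x (step e j [])             (there m) _ x≢w | yes refl = ⊥-elim (x≢w refl)
  splitAt x (step {u = u} e j (step e′ j′ W)) (there m) _ _ | yes refl = record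
    { p = u ; s = _ ; e⁻ = e ; e⁺ = e′ ; joins⁻ = j ; joins⁺ = j′ ; A = [] ; B = W
    ; vertices-split = refl ; edges-split = refl }
  splitAt x (step {u = u} e j W) (there m) _ x≢w | no x≢w′ = record
    { p = p ; s = s ; e⁻ = e⁻ ; e⁺ = e⁺ ; joins⁻ = joins⁻ ; joins⁺ = joins⁺
    ; A = step e j A ; B = B
    ; vertices-split = cong (u ∷_) vertices-split ; edges-split = cong (e ∷_) edges-split }
    where open SplitAt (splitAt x W m x≢w′ x≢w)

  split-edges-distinct : ∀ {u w x} {W : Walk G u w} → Distinct (vertices W) → (D : SplitAt W x) →
                         SplitAt.e⁻ D ≢ SplitAt.e⁺ D
  split-edges-distinct d D e⁻≡e⁺ = p∉ (there (subst (_∈ vertices B) (sym p≡s) (start∈ B)))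
    where
    open SplitAt D
    p≡s : p ≡ s
    p≡s = joins-other-end (subst (λ e → Joins G e p _) e⁻≡e⁺ joins⁻) joins⁺
    p∉ : p ∉ _ ∷ vertices B
    p∉ = proj₁ (proj₁ (proj₂ (distinct-++⁻ (frontVertices A) _ (subst Distinct vertices-split d))))

  vertexAt : ∀ {u w} (W : Walk G u w) → Fin (suc (walkLength W)) → V G
  vertexAt {u} []           _       = u
  vertexAt {u} (step e j W) zero    = u
  vertexAt     (step e j W) (suc i) = vertexAt W i

  edgeAt : ∀ {u w} (W : Walk G u w) → Fin (walkLength W) → E G
  edgeAt (step e j W) zero    = e
  edgeAt (step e j W) (suc i) = edgeAt W i

  linkAt : ∀ {u w} (W : Walk G u w) (i : Fin (walkLength W)) →
           Joins G (edgeAt W i) (vertexAt W (inject₁ i)) (vertexAt W (suc i))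
  linkAt (step e j [])             zero    = j
  linkAt (step e j (step e′ j′ W)) zero    = j
  linkAt (step e j W)              (suc i) = linkAt W i

  vertexAt-start : ∀ {u w} (W : Walk G u w) → vertexAt W zero ≡ u
  vertexAt-start []           = refl
  vertexAt-start (step e j W) = refl

  vertexAt-end : ∀ {u w} (W : Walk G u w) → vertexAt W (fromℕ (walkLength W)) ≡ w
  vertexAt-end []           = refl
  vertexAt-end (step e j W) = vertexAt-end W

  vertexAt∈ : ∀ {u w} (W : Walk G u w) i → vertexAt W i ∈ vertices W
  vertexAt∈ []           zero    = here refl
  vertexAt∈ (step e j W) zero    = here refl
  vertexAt∈ (step e j W) (suc i) = there (vertexAt∈ W i)

  ∈⇒vertexAt : ∀ {u w v} (W : Walk G u w) → v ∈ vertices W → ∃ λ i → vertexAt W i ≡ v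
  ∈⇒vertexAt []           (here refl) = zero , refl
  ∈⇒vertexAt (step e j W) (here refl) = zero , refl
  ∈⇒vertexAt (step e j W) (there m) with ∈⇒vertexAt W m
  ... | i , p = suc i , p

  edgeAt∈ : ∀ {u w} (W : Walk G u w) i → edgeAt W i ∈ edges W
  edgeAt∈ (step e j W) zero    = here refl
  edgeAt∈ (step e j W) (suc i) = there (edgeAt∈ W i)

  vertexAt-injective : ∀ {u w} (W : Walk G u w) → Distinct (vertices W) → Injective _≡_ _≡_ (vertexAt W)
  vertexAt-injective []           _ {zero}  {zero}  _ = refl
  vertexAt-injective (step e j W) _ {zero}  {zero}  _ = refl
  vertexAt-injective (step e j W) (u∉ , _) {zero} {suc y} p =
    ⊥-elim (u∉ (subst (_∈ vertices W) (sym p) (vertexAt∈ W y)))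
  vertexAt-injective (step e j W) (u∉ , _) {suc x} {zero} p =
    ⊥-elim (u∉ (subst (_∈ vertices W) p (vertexAt∈ W x)))
  vertexAt-injective (step e j W) (_ , d) {suc x} {suc y} p = cong suc (vertexAt-injective W d p)

  walk⇒path : ∀ {u w} (W : Walk G u w) → Distinct (vertices W) → Path G u w
  walk⇒path W d = record
    { len = walkLength W ; vert = vertexAt W ; vert-inj = vertexAt-injective W d ; edge = edgeAt W
    ; start = vertexAt-start W ; end = vertexAt-end W ; link = linkAt W }

  module _ {u w : V G} (W : Walk G u w) (d : Distinct (vertices W)) where

    onPath-walk⇒path⁻ : ∀ {v} → OnPath (walk⇒path W d) v → v ∈ vertices W
    onPath-walk⇒path⁻ (i , refl) = vertexAt∈ W i

    onPath-walk⇒path⁺ : ∀ {v} → v ∈ vertices W → OnPath (walk⇒path W d) v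
    onPath-walk⇒path⁺ = ∈⇒vertexAt W

    edgeOnPath-walk⇒path⁻ : ∀ {x} → EdgeOnPath (walk⇒path W d) x → x ∈ edges W
    edgeOnPath-walk⇒path⁻ (i , refl) = edgeAt∈ W i

  sequence⇒walk : (n : ℕ) (vt : Fin (suc n) → V G) (ed : Fin n → E G) →
                  (∀ i → Joins G (ed i) (vt (inject₁ i)) (vt (suc i))) → Walk G (vt zero) (vt (fromℕ n))
  sequence⇒walk zero    vt ed lk = []
  sequence⇒walk (suc n) vt ed lk =
    step (ed zero) (lk zero) (sequence⇒walk n (λ i → vt (suc i)) (λ i → ed (suc i)) (λ i → lk (suc i)))

  private
    shift : ∀ {n} (vt : Fin (suc (suc n)) → V G) (ed : Fin (suc n) → E G) →
            (∀ i → Joins G (ed i) (vt (inject₁ i)) (vt (suc i))) →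
            ∀ i → Joins G (ed (suc i)) (vt (suc (inject₁ i))) (vt (suc (suc i)))
    shift vt ed lk i = lk (suc i)

  ∈sequence⇒walk⁻ : ∀ n vt ed lk {v} → v ∈ vertices (sequence⇒walk n vt ed lk) → ∃ λ i → vt i ≡ v
  ∈sequence⇒walk⁻ zero    vt ed lk (here refl) = zero , refl
  ∈sequence⇒walk⁻ (suc n) vt ed lk (here refl) = zero , refl
  ∈sequence⇒walk⁻ (suc n) vt ed lk (there m)
    with ∈sequence⇒walk⁻ n (λ i → vt (suc i)) (λ i → ed (suc i)) (shift vt ed lk) m
  ... | i , p = suc i , p

  ∈sequence⇒walk⁺ : ∀ n vt ed lk i → vt i ∈ vertices (sequence⇒walk n vt ed lk)
  ∈sequence⇒walk⁺ zero    vt ed lk zero    = here refl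
  ∈sequence⇒walk⁺ (suc n) vt ed lk zero    = here refl
  ∈sequence⇒walk⁺ (suc n) vt ed lk (suc i) =
    there (∈sequence⇒walk⁺ n (λ i → vt (suc i)) (λ i → ed (suc i)) (shift vt ed lk) i)

  edge∈sequence⇒walk⁻ : ∀ n vt ed lk {x} → x ∈ edges (sequence⇒walk n vt ed lk) → ∃ λ i → ed i ≡ x
  edge∈sequence⇒walk⁻ (suc n) vt ed lk (here refl) = zero , refl
  edge∈sequence⇒walk⁻ (suc n) vt ed lk (there m)
    with edge∈sequence⇒walk⁻ n (λ i → vt (suc i)) (λ i → ed (suc i)) (shift vt ed lk) m
  ... | i , p = suc i , p

  sequence⇒walk-length : ∀ n vt ed lk → walkLength (sequence⇒walk n vt ed lk) ≡ n
  sequence⇒walk-length zero    vt ed lk = refl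
  sequence⇒walk-length (suc n) vt ed lk =
    cong suc (sequence⇒walk-length n (λ i → vt (suc i)) (λ i → ed (suc i)) (shift vt ed lk))

  sequence⇒walk-distinct : ∀ n vt ed lk → Injective _≡_ _≡_ vt →
                           Distinct (vertices (sequence⇒walk n vt ed lk))
  sequence⇒walk-distinct zero    vt ed lk inj = (λ ()) , tt
  sequence⇒walk-distinct (suc n) vt ed lk inj =
    vt0∉ , sequence⇒walk-distinct n (λ i → vt (suc i)) (λ i → ed (suc i)) (shift vt ed lk)
                                    (λ p → Fin.suc-injective (inj p))
    where
    vt0∉ : vt zero ∉ vertices (sequence⇒walk n (λ i → vt (suc i)) (λ i → ed (suc i)) (shift vt ed lk))
    vt0∉ m with ∈sequence⇒walk⁻ n (λ i → vt (suc i)) (λ i → ed (suc i)) (shift vt ed lk) m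
    ... | i , p with inj p
    ... | ()

  module _ {a b : V G} (P : Path G a b) where
    open Path P

    path⇒walk : Walk G a b
    path⇒walk = cast start end (sequence⇒walk len vert edge link)

    ∈path⇒walk⁻ : ∀ {v} → v ∈ vertices path⇒walk → OnPath P v
    ∈path⇒walk⁻ m = ∈sequence⇒walk⁻ len vert edge link (subst (_ ∈_) (vertices-cast start end _) m)

    ∈path⇒walk⁺ : ∀ {v} → OnPath P v → v ∈ vertices path⇒walk
    ∈path⇒walk⁺ (i , refl) =
      subst (_ ∈_) (sym (vertices-cast start end _)) (∈sequence⇒walk⁺ len vert edge link i)

    edge∈path⇒walk⁻ : ∀ {x} → x ∈ edges path⇒walk → EdgeOnPath P x
    edge∈path⇒walk⁻ m = edge∈sequence⇒walk⁻ len vert edge link (subst (_ ∈_) (edges-cast start end _) m)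

    path⇒walk-length : walkLength path⇒walk ≡ len
    path⇒walk-length = trans (cong length (edges-cast start end _)) (sequence⇒walk-length len vert edge link)

    path⇒walk-distinct : Distinct (vertices path⇒walk)
    path⇒walk-distinct =
      subst Distinct (sym (vertices-cast start end _)) (sequence⇒walk-distinct len vert edge link vert-inj)

module _ {G : Graph} {a b : V G} where

  MeetAtEnds : Walk G a b → Walk G a b → Set
  MeetAtEnds W W′ = ∀ {v} → v ∈ vertices W → v ∈ vertices W′ → v ≡ a ⊎ v ≡ b

  EdgeDisjoint : Walk G a b → Walk G a b → Set
  EdgeDisjoint W W′ = ∀ {e} → e ∈ edges W → e ∈ edges W′ → ⊥

  OnWalks : Walk G a b → Walk G a b → Walk G a b → V G → Set
  OnWalks W₁ W₂ W₃ v = v ∈ vertices W₁ ⊎ v ∈ vertices W₂ ⊎ v ∈ vertices W₃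

-- ConformalBiTheta with its paths as walks, so that disjointness becomes list membership.
record WalkTheta (G : Graph) : Set where
  field
    a b : V G
    a≢b : a ≢ b
    W₁ W₂ W₃ : Walk G a b
    distinct₁ : Distinct (vertices W₁)
    distinct₂ : Distinct (vertices W₂)
    distinct₃ : Distinct (vertices W₃)
    odd₁ : Odd (walkLength W₁)
    odd₂ : Odd (walkLength W₂)
    odd₃ : Odd (walkLength W₃)
    meet₁₂ : MeetAtEnds W₁ W₂
    meet₁₃ : MeetAtEnds W₁ W₃
    meet₂₃ : MeetAtEnds W₂ W₃
    apart₁₂ : EdgeDisjoint W₁ W₂
    apart₁₃ : EdgeDisjoint W₁ W₃
    apart₂₃ : EdgeDisjoint W₂ W₃
    conformal : PerfectMatchingAvoiding G (OnWalks W₁ W₂ W₃)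

module _ {G : Graph} where

  theta⇒walkTheta : ConformalBiTheta G → WalkTheta G
  theta⇒walkTheta T = record
    { a = a ; b = b ; a≢b = a≢b
    ; W₁ = path⇒walk P₁ ; W₂ = path⇒walk P₂ ; W₃ = path⇒walk P₃
    ; distinct₁ = path⇒walk-distinct P₁ ; distinct₂ = path⇒walk-distinct P₂
    ; distinct₃ = path⇒walk-distinct P₃
    ; odd₁ = odd P₁ even₁ ; odd₂ = odd P₂ even₂ ; odd₃ = odd P₃ even₃
    ; meet₁₂ = meet P₁ P₂ disj₁₂ ; meet₁₃ = meet P₁ P₃ disj₁₃ ; meet₂₃ = meet P₂ P₃ disj₂₃
    ; apart₁₂ = apart P₁ P₂ disj₁₂ ; apart₁₃ = apart P₁ P₃ disj₁₃ ; apart₂₃ = apart P₂ P₃ disj₂₃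
    ; conformal = matching-cong
        (λ v → ⊎-map (∈path⇒walk⁺ P₁) (⊎-map (∈path⇒walk⁺ P₂) (∈path⇒walk⁺ P₃)))
        (λ v → ⊎-map (∈path⇒walk⁻ P₁) (⊎-map (∈path⇒walk⁻ P₂) (∈path⇒walk⁻ P₃)))
        conformal }
    where
    open ConformalBiTheta T
    odd : (P : Path G a b) → EvenInternal P → Odd (walkLength (path⇒walk P))
    odd P (k , eq) = k , trans (path⇒walk-length P) eq
    meet : (P Q : Path G a b) → InternallyDisjoint P Q → MeetAtEnds (path⇒walk P) (path⇒walk Q)
    meet P Q D {v} v∈P v∈Q with v ≟ a | v ≟ b
    ... | yes v≡a | _       = inj₁ v≡a
    ... | no _    | yes v≡b = inj₂ v≡b
    ... | no v≢a  | no v≢b  = ⊥-elim (proj₁ D v (∈path⇒walk⁻ P v∈P , v≢a , v≢b) (∈path⇒walk⁻ Q v∈Q))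
    apart : (P Q : Path G a b) → InternallyDisjoint P Q → EdgeDisjoint (path⇒walk P) (path⇒walk Q)
    apart P Q D e∈P e∈Q = proj₂ D _ (edge∈path⇒walk⁻ P e∈P) (edge∈path⇒walk⁻ Q e∈Q)

  walkTheta⇒theta : WalkTheta G → ConformalBiTheta G
  walkTheta⇒theta T = record
    { a = a ; b = b ; a≢b = a≢b
    ; P₁ = walk⇒path W₁ distinct₁ ; P₂ = walk⇒path W₂ distinct₂ ; P₃ = walk⇒path W₃ distinct₃
    ; even₁ = odd₁ ; even₂ = odd₂ ; even₃ = odd₃
    ; disj₁₂ = disjoint W₁ W₂ distinct₁ distinct₂ meet₁₂ apart₁₂
    ; disj₁₃ = disjoint W₁ W₃ distinct₁ distinct₃ meet₁₃ apart₁₃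
    ; disj₂₃ = disjoint W₂ W₃ distinct₂ distinct₃ meet₂₃ apart₂₃
    ; conformal = matching-cong
        (λ v → ⊎-map (onPath-walk⇒path⁺ W₁ distinct₁)
                 (⊎-map (onPath-walk⇒path⁺ W₂ distinct₂) (onPath-walk⇒path⁺ W₃ distinct₃)))
        (λ v → ⊎-map (onPath-walk⇒path⁻ W₁ distinct₁)
                 (⊎-map (onPath-walk⇒path⁻ W₂ distinct₂) (onPath-walk⇒path⁻ W₃ distinct₃)))
        conformal }
    where
    open WalkTheta T
    disjoint : (X Y : Walk G a b) (dX : Distinct (vertices X)) (dY : Distinct (vertices Y)) →
               MeetAtEnds X Y → EdgeDisjoint X Y → InternallyDisjoint (walk⇒path X dX) (walk⇒path Y dY)
    disjoint X Y dX dY meet apart = internal , λ e p q →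
      apart (edgeOnPath-walk⇒path⁻ X dX p) (edgeOnPath-walk⇒path⁻ Y dY q)
      where
      internal : ∀ v → Internal (walk⇒path X dX) v → ¬ OnPath (walk⇒path Y dY) v
      internal v (o , v≢a , v≢b) o′
        with meet (onPath-walk⇒path⁻ X dX o) (onPath-walk⇒path⁻ Y dY o′)
      ... | inj₁ v≡a = v≢a v≡a
      ... | inj₂ v≡b = v≢b v≡b

  swap₁₂ : WalkTheta G → WalkTheta G
  swap₁₂ T = record
    { a = a ; b = b ; a≢b = a≢b ; W₁ = W₂ ; W₂ = W₁ ; W₃ = W₃
    ; distinct₁ = distinct₂ ; distinct₂ = distinct₁ ; distinct₃ = distinct₃
    ; odd₁ = odd₂ ; odd₂ = odd₁ ; odd₃ = odd₃
    ; meet₁₂ = λ p q → meet₁₂ q p ; meet₁₃ = meet₂₃ ; meet₂₃ = meet₁₃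
    ; apart₁₂ = λ p q → apart₁₂ q p ; apart₁₃ = apart₂₃ ; apart₂₃ = apart₁₃
    ; conformal = matching-cong (λ v → permute) (λ v → permute) conformal }
    where
    open WalkTheta T
    permute : ∀ {A B C : Set} → A ⊎ B ⊎ C → B ⊎ A ⊎ C
    permute (inj₁ x)        = inj₂ (inj₁ x)
    permute (inj₂ (inj₁ x)) = inj₁ x
    permute (inj₂ (inj₂ x)) = inj₂ (inj₂ x)

  swap₁₃ : WalkTheta G → WalkTheta G
  swap₁₃ T = record
    { a = a ; b = b ; a≢b = a≢b ; W₁ = W₃ ; W₂ = W₂ ; W₃ = W₁
    ; distinct₁ = distinct₃ ; distinct₂ = distinct₂ ; distinct₃ = distinct₁
    ; odd₁ = odd₃ ; odd₂ = odd₂ ; odd₃ = odd₁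
    ; meet₁₂ = λ p q → meet₂₃ q p ; meet₁₃ = λ p q → meet₁₃ q p ; meet₂₃ = λ p q → meet₁₂ q p
    ; apart₁₂ = λ p q → apart₂₃ q p ; apart₁₃ = λ p q → apart₁₃ q p ; apart₂₃ = λ p q → apart₁₂ q p
    ; conformal = matching-cong (λ v → permute) (λ v → permute) conformal }
    where
    open WalkTheta T
    permute : ∀ {A B C : Set} → A ⊎ B ⊎ C → C ⊎ B ⊎ A
    permute (inj₁ x)        = inj₂ (inj₂ x)
    permute (inj₂ (inj₁ x)) = inj₂ (inj₁ x)
    permute (inj₂ (inj₂ x)) = inj₁ x

  swap₂₃ : WalkTheta G → WalkTheta G
  swap₂₃ T = record
    { a = a ; b = b ; a≢b = a≢b ; W₁ = W₁ ; W₂ = W₃ ; W₃ = W₂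
    ; distinct₁ = distinct₁ ; distinct₂ = distinct₃ ; distinct₃ = distinct₂
    ; odd₁ = odd₁ ; odd₂ = odd₃ ; odd₃ = odd₂
    ; meet₁₂ = meet₁₃ ; meet₁₃ = meet₁₂ ; meet₂₃ = λ p q → meet₂₃ q p
    ; apart₁₂ = apart₁₃ ; apart₁₃ = apart₁₂ ; apart₂₃ = λ p q → apart₂₃ q p
    ; conformal = matching-cong (λ v → permute) (λ v → permute) conformal }
    where
    open WalkTheta T
    permute : ∀ {A B C : Set} → A ⊎ B ⊎ C → A ⊎ C ⊎ B
    permute (inj₁ x)        = inj₁ x
    permute (inj₂ (inj₁ x)) = inj₂ (inj₂ x)
    permute (inj₂ (inj₂ x)) = inj₂ (inj₁ x)

  reverseTheta : WalkTheta G → WalkTheta G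
  reverseTheta T = record
    { a = b ; b = a ; a≢b = λ eq → a≢b (sym eq)
    ; W₁ = reverseʷ W₁ ; W₂ = reverseʷ W₂ ; W₃ = reverseʷ W₃
    ; distinct₁ = distinct-reverseʷ W₁ distinct₁ ; distinct₂ = distinct-reverseʷ W₂ distinct₂
    ; distinct₃ = distinct-reverseʷ W₃ distinct₃
    ; odd₁ = subst Odd (sym (walkLength-reverse W₁)) odd₁
    ; odd₂ = subst Odd (sym (walkLength-reverse W₂)) odd₂
    ; odd₃ = subst Odd (sym (walkLength-reverse W₃)) odd₃
    ; meet₁₂ = meet W₁ W₂ meet₁₂ ; meet₁₃ = meet W₁ W₃ meet₁₃ ; meet₂₃ = meet W₂ W₃ meet₂₃
    ; apart₁₂ = apart W₁ W₂ apart₁₂ ; apart₁₃ = apart W₁ W₃ apart₁₃ ; apart₂₃ = apart W₂ W₃ apart₂₃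
    ; conformal = matching-cong
        (λ v → ⊎-map (∈vertices-reverse⁺ W₁) (⊎-map (∈vertices-reverse⁺ W₂) (∈vertices-reverse⁺ W₃)))
        (λ v → ⊎-map (∈vertices-reverse⁻ W₁) (⊎-map (∈vertices-reverse⁻ W₂) (∈vertices-reverse⁻ W₃)))
        conformal }
    where
    open WalkTheta T
    meet : (X Y : Walk G a b) → MeetAtEnds X Y → MeetAtEnds (reverseʷ X) (reverseʷ Y)
    meet X Y m p q = swap (m (∈vertices-reverse⁻ X p) (∈vertices-reverse⁻ Y q))
    apart : (X Y : Walk G a b) → EdgeDisjoint X Y → EdgeDisjoint (reverseʷ X) (reverseʷ Y)
    apart X Y d p q = d (∈edges-reverse⁻ X p) (∈edges-reverse⁻ Y q)

  degree≤2-not-end : (T : WalkTheta G) {x : V G} {e₁ e₂ : E G} → (∀ e → Inc G e x → e ≡ e₁ ⊎ e ≡ e₂) →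
                     ((W : Walk G (WalkTheta.a T) (WalkTheta.b T)) → ∃ λ e → e ∈ edges W × Inc G e x) → ⊥
  degree≤2-not-end T inc-x at-end
    with at-end W₁ | at-end W₂ | at-end W₃
    where open WalkTheta T
  ... | e , m₁ , i₁ | e′ , m₂ , i₂ | e″ , m₃ , i₃ with pigeonhole (inc-x e i₁) (inc-x e′ i₂) (inc-x e″ i₃)
  ... | inj₁ refl        = WalkTheta.apart₁₂ T m₁ m₂
  ... | inj₂ (inj₁ refl) = WalkTheta.apart₁₃ T m₁ m₃
  ... | inj₂ (inj₂ refl) = WalkTheta.apart₂₃ T m₂ m₃

  degree≤2-≢a : (T : WalkTheta G) {x : V G} {e₁ e₂ : E G} → (∀ e → Inc G e x → e ≡ e₁ ⊎ e ≡ e₂) →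
                x ≢ WalkTheta.a T
  degree≤2-≢a T inc-x refl = degree≤2-not-end T inc-x (λ W → first-edge W (WalkTheta.a≢b T))

  degree≤2-≢b : (T : WalkTheta G) {x : V G} {e₁ e₂ : E G} → (∀ e → Inc G e x → e ≡ e₁ ⊎ e ≡ e₂) →
                x ≢ WalkTheta.b T
  degree≤2-≢b T inc-x refl = degree≤2-not-end T inc-x (λ W → last-edge W (WalkTheta.a≢b T))

degreeTwo-swap : ∀ {G v₀ v₁ v₂ e₁ e₂} → DegreeTwo G v₀ v₁ v₂ e₁ e₂ → DegreeTwo G v₀ v₂ v₁ e₂ e₁
degreeTwo-swap (e₁≢e₂ , j₁ , j₂ , inc-v₀) = (λ eq → e₁≢e₂ (sym eq)) , j₂ , j₁ , (λ e i → swap (inc-v₀ e i))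

contraction-swap : ∀ {G H v₀ v₁ v₂ e₁ e₂} → Contraction G v₀ v₁ v₂ e₁ e₂ H → Contraction G v₀ v₂ v₁ e₂ e₁ H
contraction-swap C = record
  { f = f ; f-surj = f-surj ; f-v₁ = f-v₂ ; f-v₂ = f-v₁
  ; f-inj = λ x y eq → ⊎-map id (λ { (sx , sy) → special-swap sx , special-swap sy }) (f-inj x y eq)
  ; g = g ; g-inj = g-inj ; g-avoid = λ e′ → Product.swap (g-avoid e′)
  ; g-surj = λ e e≢e₂ e≢e₁ → g-surj e e≢e₁ e≢e₂ ; g-ends = g-ends }
  where
  open Contraction C
  special-swap : ∀ {A : Set} {x y z : A} {w : A} → w ≡ x ⊎ w ≡ y ⊎ w ≡ z → w ≡ x ⊎ w ≡ z ⊎ w ≡ y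
  special-swap = ⊎-map id swap

module Contracted (G H : Graph) (v₀ v₁ v₂ : V G) (e₁ e₂ : E G) (v₁≢v₂ : v₁ ≢ v₂)
                  (deg : DegreeTwo G v₀ v₁ v₂ e₁ e₂) (C : Contraction G v₀ v₁ v₂ e₁ e₂ H) where

  open Ends G public
  module EH = Ends H
  open Contraction C public

  Special : V G → Set
  Special x = x ≡ v₀ ⊎ x ≡ v₁ ⊎ x ≡ v₂

  special? : ∀ x → Dec (Special x)
  special? x = (x ≟ v₀) ⊎-dec (x ≟ v₁) ⊎-dec (x ≟ v₂)

  c : V H
  c = f v₀

  e₁≢e₂ : e₁ ≢ e₂
  e₁≢e₂ = proj₁ deg

  joins₁ : Joins G e₁ v₀ v₁
  joins₁ = proj₁ (proj₂ deg)

  joins₂ : Joins G e₂ v₀ v₂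
  joins₂ = proj₁ (proj₂ (proj₂ deg))

  inc-v₀ : ∀ e → Inc G e v₀ → e ≡ e₁ ⊎ e ≡ e₂
  inc-v₀ = proj₂ (proj₂ (proj₂ deg))

  v₀≢v₁ : v₀ ≢ v₁
  v₀≢v₁ = joins⇒≢ joins₁

  v₀≢v₂ : v₀ ≢ v₂
  v₀≢v₂ = joins⇒≢ joins₂

  f-special : ∀ {x} → Special x → f x ≡ c
  f-special (inj₁ refl)        = refl
  f-special (inj₂ (inj₁ refl)) = sym f-v₁
  f-special (inj₂ (inj₂ refl)) = sym f-v₂

  f≡c⇒special : ∀ {x} → f x ≡ c → Special x
  f≡c⇒special {x} eq with f-inj x v₀ eq
  ... | inj₁ refl    = inj₁ refl
  ... | inj₂ (s , _) = s

  f-injective : ∀ {x y} → f x ≡ f y → x ≡ y ⊎ (Special x × Special y)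
  f-injective {x} {y} = f-inj x y

  g-avoids-v₀ : ∀ e′ → ¬ Inc G (g e′) v₀
  g-avoids-v₀ e′ i with inc-v₀ (g e′) i
  ... | inj₁ p = proj₁ (g-avoid e′) p
  ... | inj₂ p = proj₂ (g-avoid e′) p

  inc-H⇒G : ∀ {e′ y} → Inc H e′ y → ∃ λ z → Inc G (g e′) z × f z ≡ y
  inc-H⇒G {e′} i with EH.inc-joins (g-ends e′) i
  ... | inj₁ p = src G (g e′) , inj₁ refl , sym p
  ... | inj₂ p = tgt G (g e′) , inj₂ refl , sym p

  inc-G⇒H : ∀ {e′ z} → Inc G (g e′) z → Inc H e′ (f z)
  inc-G⇒H {e′} (inj₁ refl) = EH.joins⇒inc₁ (g-ends e′)
  inc-G⇒H {e′} (inj₂ refl) = EH.joins⇒inc₂ (g-ends e′)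

  inc-special⇒inc-c : ∀ {e′ z} → Inc G (g e′) z → Special z → Inc H e′ c
  inc-special⇒inc-c {e′} i s = subst (Inc H e′) (f-special s) (inc-G⇒H i)

  ends-not-both-special : ∀ e′ → Special (src G (g e′)) → Special (tgt G (g e′)) → ⊥
  ends-not-both-special e′ s t =
    EH.joins-irrefl (subst (λ z → Joins H e′ z c) (f-special s) (subst (Joins H e′ _) (f-special t) (g-ends e′)))

  special-end-unique : ∀ {e′ x y} → Inc G (g e′) x → Inc G (g e′) y → Special x → Special y → x ≡ y
  special-end-unique      (inj₁ refl) (inj₁ refl) _ _ = refl
  special-end-unique      (inj₂ refl) (inj₂ refl) _ _ = refl
  special-end-unique {e′} (inj₁ refl) (inj₂ refl) s t = ⊥-elim (ends-not-both-special e′ s t)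
  special-end-unique {e′} (inj₂ refl) (inj₁ refl) s t = ⊥-elim (ends-not-both-special e′ t s)

  joins-H⇒G : ∀ {e′ u′ w′} → Joins H e′ u′ w′ → ∃₂ λ s t → Joins G (g e′) s t × f s ≡ u′ × f t ≡ w′
  joins-H⇒G {e′} j with EH.joins-unique (g-ends e′) j
  ... | inj₁ (p , q) = _ , _ , inj₁ (refl , refl) , p , q
  ... | inj₂ (p , q) = _ , _ , inj₂ (refl , refl) , q , p

  joins-G⇒H : ∀ {e′ x y} → Joins G (g e′) x y → Joins H e′ (f x) (f y)
  joins-G⇒H {e′} (inj₁ (refl , refl)) = g-ends e′
  joins-G⇒H {e′} (inj₂ (refl , refl)) = EH.joins-sym (g-ends e′)

  f⁻¹ : V H → V G
  f⁻¹ y = proj₁ (f-surj y)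

  f∘f⁻¹ : ∀ y → f (f⁻¹ y) ≡ y
  f∘f⁻¹ y = proj₂ (f-surj y)

  f⁻¹∘f : ∀ {x} → ¬ Special x → f⁻¹ (f x) ≡ x
  f⁻¹∘f {x} ¬sx with f-inj (f⁻¹ (f x)) x (f∘f⁻¹ (f x))
  ... | inj₁ p       = p
  ... | inj₂ (_ , s) = ⊥-elim (¬sx s)

  f⁻¹-nonspecial : ∀ {y} → y ≢ c → ¬ Special (f⁻¹ y)
  f⁻¹-nonspecial {y} y≢c s = y≢c (trans (sym (f∘f⁻¹ y)) (f-special s))

  f⁻¹-injective : ∀ {y y′} → f⁻¹ y ≡ f⁻¹ y′ → y ≡ y′
  f⁻¹-injective {y} {y′} eq = trans (sym (f∘f⁻¹ y)) (trans (cong f eq) (f∘f⁻¹ y′))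

  ∈map-f⁻¹⇒nonspecial : ∀ {ys x} → c ∉ ys → x ∈ map f⁻¹ ys → ¬ Special x
  ∈map-f⁻¹⇒nonspecial c∉ m sx with ∈-map⁻ f⁻¹ m
  ... | y , y∈ , refl = f⁻¹-nonspecial (λ y≡c → c∉ (subst (_∈ _) y≡c y∈)) sx

  special-edge⇒v₀∈ : ∀ {u w e} (W : Walk G u w) → e ∈ edges W → e ≡ e₁ ⊎ e ≡ e₂ → v₀ ∈ vertices W
  special-edge⇒v₀∈ W m (inj₁ refl) = inc∈vertices W m (joins⇒inc₁ joins₁)
  special-edge⇒v₀∈ W m (inj₂ refl) = inc∈vertices W m (joins⇒inc₁ joins₂)

  edge-off-v₀ : ∀ {e u w} → Joins G e u w → v₀ ≢ u → v₀ ≢ w → e ≢ e₁ × e ≢ e₂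
  edge-off-v₀ j v₀≢u v₀≢w = (λ { refl → at-v₀ (joins⇒inc₁ joins₁) }) , (λ { refl → at-v₀ (joins⇒inc₁ joins₂) })
    where
    at-v₀ : Inc G _ v₀ → ⊥
    at-v₀ i with inc-joins j i
    ... | inj₁ p = v₀≢u p
    ... | inj₂ p = v₀≢w p

  project-edge : ∀ {e u w} → Joins G e u w → v₀ ≢ u → v₀ ≢ w →
                 Σ (E H) λ e′ → g e′ ≡ e × Joins H e′ (f u) (f w)
  project-edge {e} j v₀≢u v₀≢w with g-surj e (proj₁ (edge-off-v₀ j v₀≢u v₀≢w)) (proj₂ (edge-off-v₀ j v₀≢u v₀≢w))
  ... | e′ , refl = e′ , refl , joins-G⇒H j

  private
    v₀∉-step : ∀ {e u w x} (j : Joins G e u w) (W : Walk G w x) → v₀ ∉ vertices (step e j W) →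
               v₀ ≢ u × v₀ ≢ w
    v₀∉-step j W v₀∉ = (λ p → v₀∉ (here p)) , (λ p → v₀∉ (there (subst (_∈ vertices W) (sym p) (start∈ W))))

    project-step : ∀ {e u w x} (j : Joins G e u w) (W : Walk G w x) → v₀ ∉ vertices (step e j W) →
                   Σ (E H) λ e′ → g e′ ≡ e × Joins H e′ (f u) (f w)
    project-step j W v₀∉ = project-edge j (proj₁ (v₀∉-step j W v₀∉)) (proj₂ (v₀∉-step j W v₀∉))

  project : ∀ {u w} (W : Walk G u w) → v₀ ∉ vertices W → Walk H (f u) (f w)
  project []           _   = []
  project (step e j W) v₀∉ =
    step (proj₁ (project-step j W v₀∉)) (proj₂ (proj₂ (project-step j W v₀∉))) (project W (λ m → v₀∉ (there m)))

  project-vertices : ∀ {u w} (W : Walk G u w) v₀∉ → vertices (project W v₀∉) ≡ map f (vertices W)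
  project-vertices []           _ = refl
  project-vertices (step e j W) _ = cong (_ ∷_) (project-vertices W _)

  project-frontVertices : ∀ {u w} (W : Walk G u w) v₀∉ →
                          frontVertices (project W v₀∉) ≡ map f (frontVertices W)
  project-frontVertices []           _ = refl
  project-frontVertices (step e j W) _ = cong (_ ∷_) (project-frontVertices W _)

  project-edges : ∀ {u w} (W : Walk G u w) v₀∉ → map g (edges (project W v₀∉)) ≡ edges W
  project-edges []           _   = refl
  project-edges (step e j W) v₀∉ = cong₂ _∷_ (proj₁ (proj₂ (project-step j W v₀∉))) (project-edges W _)

  project-length : ∀ {u w} (W : Walk G u w) v₀∉ → walkLength (project W v₀∉) ≡ walkLength W
  project-length W v₀∉ = trans (sym (length-map g (edges (project W v₀∉)))) (cong length (project-edges W v₀∉))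

  project-edge∈ : ∀ {u w} (W : Walk G u w) v₀∉ {e′} → e′ ∈ edges (project W v₀∉) → g e′ ∈ edges W
  project-edge∈ W v₀∉ m = subst (_ ∈_) (project-edges W v₀∉) (∈-map⁺ g m)

  lift-edge : ∀ {e′ u′ w′} → Joins H e′ u′ w′ → u′ ≢ c → w′ ≢ c → Joins G (g e′) (f⁻¹ u′) (f⁻¹ w′)
  lift-edge j u′≢c w′≢c with joins-H⇒G j
  ... | s , t , J , refl , refl =
    subst₂ (Joins G _) (sym (f⁻¹∘f (λ z → u′≢c (f-special z)))) (sym (f⁻¹∘f (λ z → w′≢c (f-special z)))) J

  lift-edge-at-c : ∀ {e′ x} → Joins H e′ x c → x ≢ c → ∃ λ z → Joins G (g e′) (f⁻¹ x) z × (z ≡ v₁ ⊎ z ≡ v₂)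
  lift-edge-at-c {e′} j x≢c with joins-H⇒G j
  ... | t , z , J , f-t , f-z with f≡c⇒special f-z
  ... | inj₁ refl = ⊥-elim (g-avoids-v₀ e′ (joins⇒inc₂ J))
  ... | inj₂ z-special = z , subst (λ u → Joins G (g e′) u z) (trans (sym (f⁻¹∘f ¬st)) (cong f⁻¹ f-t)) J , z-special
    where
    ¬st : ¬ Special t
    ¬st s = x≢c (trans (sym f-t) (f-special s))

  lift : ∀ {u′ w′} (W : Walk H u′ w′) → c ∉ vertices W → Walk G (f⁻¹ u′) (f⁻¹ w′)
  lift []           _  = []
  lift (step e′ j W) c∉ =
    step (g e′) (lift-edge j (λ p → c∉ (here (sym p))) (λ p → c∉ (there (subst (_∈ vertices W) p (start∈ W)))))
         (lift W (λ m → c∉ (there m)))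

  lift-vertices : ∀ {u w} (W : Walk H u w) c∉ → vertices (lift W c∉) ≡ map f⁻¹ (vertices W)
  lift-vertices []           _ = refl
  lift-vertices (step e j W) _ = cong (_ ∷_) (lift-vertices W _)

  lift-frontVertices : ∀ {u w} (W : Walk H u w) c∉ → frontVertices (lift W c∉) ≡ map f⁻¹ (frontVertices W)
  lift-frontVertices []           _ = refl
  lift-frontVertices (step e j W) _ = cong (_ ∷_) (lift-frontVertices W _)

  lift-edges : ∀ {u w} (W : Walk H u w) c∉ → edges (lift W c∉) ≡ map g (edges W)
  lift-edges []           _ = refl
  lift-edges (step e j W) _ = cong (_ ∷_) (lift-edges W _)

  lift-length : ∀ {u w} (W : Walk H u w) c∉ → walkLength (lift W c∉) ≡ walkLength W
  lift-length W c∉ = trans (cong length (lift-edges W c∉)) (length-map g (edges W))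

module ThetaToContraction (G H : Graph) (v₀ v₁ v₂ : V G) (e₁ e₂ : E G) (v₁≢v₂ : v₁ ≢ v₂)
                          (deg : DegreeTwo G v₀ v₁ v₂ e₁ e₂) (C : Contraction G v₀ v₁ v₂ e₁ e₂ H) where

  open Contracted G H v₀ v₁ v₂ e₁ e₂ v₁≢v₂ deg C

  module _ (T : WalkTheta G) where
    open WalkTheta T
    open PerfectMatchingAvoiding conformal

    OnTheta : V G → Set
    OnTheta = OnWalks W₁ W₂ W₃

    matched⇒offTheta : ∀ {e x} → M e ≡ true → Inc G e x → ¬ OnTheta x
    matched⇒offTheta {e} m (inj₁ refl) = proj₁ (avoid e m)
    matched⇒offTheta {e} m (inj₂ refl) = proj₂ (avoid e m)

    cover-via-g : ∀ {x y e} → M e ≡ true → Inc G e x → e ≢ e₁ → e ≢ e₂ → f x ≡ y →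
                  ∃ λ e′ → M (g e′) ≡ true × Inc H e′ y
    cover-via-g {e = e} me ie e≢e₁ e≢e₂ fx≡y with g-surj e e≢e₁ e≢e₂
    ... | e′ , refl = e′ , me , subst (Inc H e′) fx≡y (inc-G⇒H ie)

    cover-nonspecial-via-g : ∀ {x y e} → M e ≡ true → Inc G e x → ¬ Special x → f x ≡ y →
                             ∃ λ e′ → M (g e′) ≡ true × Inc H e′ y
    cover-nonspecial-via-g me ie ¬s = cover-via-g me ie e≢e₁ e≢e₂
      where
      e≢e₁ : _ ≢ e₁
      e≢e₁ refl = ¬s (⊎-map id inj₁ (inc-joins joins₁ ie))
      e≢e₂ : _ ≢ e₂
      e≢e₂ refl = ¬s (⊎-map id inj₂ (inc-joins joins₂ ie))

    unique-via-g : (∀ {e′ z} → M (g e′) ≡ true → Inc G (g e′) z → Special z → z ≡ v₂) →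
      ∀ y e′ e″ → M (g e′) ≡ true → M (g e″) ≡ true → Inc H e′ y → Inc H e″ y → e′ ≡ e″
    unique-via-g only-v₂ y e′ e″ m′ m″ i′ i″ with inc-H⇒G i′ | inc-H⇒G i″
    ... | z , iz , fz | z″ , iz″ , fz″ with z ≟ z″
    ... | yes refl = g-inj (unique z (g e′) (g e″) m′ m″ iz iz″)
    ... | no z≢z″ with f-injective (trans fz (sym fz″))
    ... | inj₁ p          = ⊥-elim (z≢z″ p)
    ... | inj₂ (sz , sz″) = ⊥-elim (z≢z″ (trans (only-v₂ m′ iz sz) (sym (only-v₂ m″ iz″ sz″))))

    record Projected (W : Walk G a b) : Set where
      field
        X              : Walk H (f a) (f b)
        L              : List (V G)
        vertices-X     : vertices X ≡ map f L
        L⊆W            : ∀ {x} → x ∈ L → x ∈ vertices W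
        distinct       : Distinct (vertices X)
        odd            : Odd (walkLength X)
        edge∈W         : ∀ {e′} → e′ ∈ edges X → g e′ ∈ edges W

    open Projected

    ∈projected⁻ : ∀ {W} (I : Projected W) {y} → y ∈ vertices (X I) → ∃ λ x → x ∈ vertices W × y ≡ f x
    ∈projected⁻ I m with ∈-map⁻ f (subst (_ ∈_) (vertices-X I) m)
    ... | x , x∈ , eq = x , L⊆W I x∈ , eq

    SpecialMeetsAtEnds : Walk G a b → Walk G a b → Set
    SpecialMeetsAtEnds Wi Wj = ∀ {x x′} → x ∈ vertices Wi → x′ ∈ vertices Wj → Special x → Special x′ → x ≢ x′ →
                               f x′ ≡ f a ⊎ f x′ ≡ f b

    projected-meet : ∀ {Wi Wj} (Ii : Projected Wi) (Ij : Projected Wj) → MeetAtEnds Wi Wj →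
                     SpecialMeetsAtEnds Wi Wj → MeetAtEnds (X Ii) (X Ij)
    projected-meet Ii Ij meet special mi mj with ∈projected⁻ Ii mi | ∈projected⁻ Ij mj
    ... | x , x∈ , refl | x′ , x′∈ , eq with x ≟ x′
    ... | yes refl = ⊎-map (cong f) (cong f) (meet x∈ x′∈)
    ... | no x≢x′ with f-injective eq
    ... | inj₁ p         = ⊥-elim (x≢x′ p)
    ... | inj₂ (sx , sx′) = ⊎-map (trans eq) (trans eq) (special x∈ x′∈ sx sx′ x≢x′)

    onProjected⁻ : ∀ {I₁ : Projected W₁} {I₂ : Projected W₂} {I₃ : Projected W₃} {y} →
                   OnWalks (X I₁) (X I₂) (X I₃) y → ∃ λ x → OnTheta x × y ≡ f x
    onProjected⁻ {I₁} (inj₁ m) with ∈projected⁻ I₁ m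
    ... | x , x∈ , eq = x , inj₁ x∈ , eq
    onProjected⁻ {I₂ = I₂} (inj₂ (inj₁ m)) with ∈projected⁻ I₂ m
    ... | x , x∈ , eq = x , inj₂ (inj₁ x∈) , eq
    onProjected⁻ {I₃ = I₃} (inj₂ (inj₂ m)) with ∈projected⁻ I₃ m
    ... | x , x∈ , eq = x , inj₂ (inj₂ x∈) , eq

    assemble : (I₁ : Projected W₁) (I₂ : Projected W₂) (I₃ : Projected W₃) → f a ≢ f b →
      SpecialMeetsAtEnds W₁ W₂ → SpecialMeetsAtEnds W₁ W₃ → SpecialMeetsAtEnds W₂ W₃ →
      PerfectMatchingAvoiding H (OnWalks (X I₁) (X I₂) (X I₃)) → WalkTheta H
    assemble I₁ I₂ I₃ fa≢fb s₁₂ s₁₃ s₂₃ conformal′ = record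
      { a = f a ; b = f b ; a≢b = fa≢fb
      ; W₁ = X I₁ ; W₂ = X I₂ ; W₃ = X I₃
      ; distinct₁ = distinct I₁ ; distinct₂ = distinct I₂ ; distinct₃ = distinct I₃
      ; odd₁ = odd I₁ ; odd₂ = odd I₂ ; odd₃ = odd I₃
      ; meet₁₂ = projected-meet I₁ I₂ meet₁₂ s₁₂
      ; meet₁₃ = projected-meet I₁ I₃ meet₁₃ s₁₃
      ; meet₂₃ = projected-meet I₂ I₃ meet₂₃ s₂₃
      ; apart₁₂ = λ p q → apart₁₂ (edge∈W I₁ p) (edge∈W I₂ q)
      ; apart₁₃ = λ p q → apart₁₃ (edge∈W I₁ p) (edge∈W I₃ q)
      ; apart₂₃ = λ p q → apart₂₃ (edge∈W I₂ p) (edge∈W I₃ q)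
      ; conformal = conformal′ }

    module V₀OffTheta (v₀∉W₁ : v₀ ∉ vertices W₁) (v₀∉W₂ : v₀ ∉ vertices W₂) (v₀∉W₃ : v₀ ∉ vertices W₃)
                      (e₁-matched : M e₁ ≡ true) where

      v₀-off : ¬ OnTheta v₀
      v₀-off (inj₁ m)        = v₀∉W₁ m
      v₀-off (inj₂ (inj₁ m)) = v₀∉W₂ m
      v₀-off (inj₂ (inj₂ m)) = v₀∉W₃ m

      v₁-off : ¬ OnTheta v₁
      v₁-off = matched⇒offTheta e₁-matched (joins⇒inc₂ joins₁)

      special-onTheta : ∀ {x} → OnTheta x → Special x → x ≡ v₂
      special-onTheta k (inj₁ refl)        = ⊥-elim (v₀-off k)
      special-onTheta k (inj₂ (inj₁ refl)) = ⊥-elim (v₁-off k)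
      special-onTheta k (inj₂ (inj₂ p))    = p

      f-injective-onTheta : ∀ {x y} → OnTheta x → OnTheta y → f x ≡ f y → x ≡ y
      f-injective-onTheta kx ky eq with f-injective eq
      ... | inj₁ p        = p
      ... | inj₂ (sx , sy) = trans (special-onTheta kx sx) (sym (special-onTheta ky sy))

      projected : (W : Walk G a b) (v₀∉ : v₀ ∉ vertices W) → Distinct (vertices W) → Odd (walkLength W) →
                  (∀ {x} → x ∈ vertices W → OnTheta x) → Projected W
      projected W v₀∉ d o onTheta = record
        { X = project W v₀∉ ; L = vertices W ; vertices-X = project-vertices W v₀∉ ; L⊆W = λ m → m
        ; distinct = subst Distinct (sym (project-vertices W v₀∉))
                       (distinct-map⁺ f (vertices W) d (λ p q → f-injective-onTheta (onTheta p) (onTheta q)))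
        ; odd = subst Odd (sym (project-length W v₀∉)) o
        ; edge∈W = project-edge∈ W v₀∉ }

      I₁ = projected W₁ v₀∉W₁ distinct₁ odd₁ inj₁
      I₂ = projected W₂ v₀∉W₂ distinct₂ odd₂ (λ m → inj₂ (inj₁ m))
      I₃ = projected W₃ v₀∉W₃ distinct₃ odd₃ (λ m → inj₂ (inj₂ m))

      OnTheta′ : V H → Set
      OnTheta′ = OnWalks (X I₁) (X I₂) (X I₃)

      onTheta⇒onTheta′ : ∀ {x} → OnTheta x → OnTheta′ (f x)
      onTheta⇒onTheta′ (inj₁ m)        = inj₁ (subst (_ ∈_) (sym (project-vertices W₁ v₀∉W₁)) (∈-map⁺ f m))
      onTheta⇒onTheta′ (inj₂ (inj₁ m)) = inj₂ (inj₁ (subst (_ ∈_) (sym (project-vertices W₂ v₀∉W₂)) (∈-map⁺ f m)))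
      onTheta⇒onTheta′ (inj₂ (inj₂ m)) = inj₂ (inj₂ (subst (_ ∈_) (sym (project-vertices W₃ v₀∉W₃)) (∈-map⁺ f m)))

      matched-special-end : ∀ {e′ z} → M (g e′) ≡ true → Inc G (g e′) z → Special z → z ≡ v₂
      matched-special-end {e′} m i (inj₁ refl) = ⊥-elim (g-avoids-v₀ e′ i)
      matched-special-end {e′} m i (inj₂ (inj₁ refl)) =
        ⊥-elim (proj₁ (g-avoid e′) (unique v₁ (g e′) e₁ m e₁-matched i (joins⇒inc₂ joins₁)))
      matched-special-end m i (inj₂ (inj₂ p)) = p

      avoid′ : ∀ {e′ y} → Inc H e′ y → M (g e′) ≡ true → ¬ OnTheta′ y
      avoid′ i m k with inc-H⇒G i | onProjected⁻ {I₁} {I₂} {I₃} k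
      ... | z , iz , refl | x , kx , eq with f-injective eq
      ... | inj₁ refl     = matched⇒offTheta m iz kx
      ... | inj₂ (sz , sx) =
        matched⇒offTheta m iz (subst OnTheta (trans (special-onTheta kx sx) (sym (matched-special-end m iz sz))) kx)

      cover-nonspecial : ∀ y → ¬ OnTheta′ y → ¬ Special (f⁻¹ y) → ∃ λ e′ → M (g e′) ≡ true × Inc H e′ y
      cover-nonspecial y y-off ¬s with cover (f⁻¹ y) (λ k → y-off (subst OnTheta′ (f∘f⁻¹ y) (onTheta⇒onTheta′ k)))
      ... | e , me , ie = cover-nonspecial-via-g me ie ¬s (f∘f⁻¹ y)

      cover-c : ¬ OnTheta′ c → ∃ λ e′ → M (g e′) ≡ true × Inc H e′ c
      cover-c c-off with cover v₂ (λ k → c-off (subst OnTheta′ (sym f-v₂) (onTheta⇒onTheta′ k)))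
      ... | e , me , ie = cover-via-g me ie e≢e₁ e≢e₂ (sym f-v₂)
        where
        e≢e₁ : e ≢ e₁
        e≢e₁ refl with inc-joins joins₁ ie
        ... | inj₁ p = v₀≢v₂ (sym p)
        ... | inj₂ p = v₁≢v₂ (sym p)
        e≢e₂ : e ≢ e₂
        e≢e₂ refl = e₁≢e₂ (unique v₀ e₁ e₂ e₁-matched me (joins⇒inc₁ joins₁) (joins⇒inc₁ joins₂))

      cover′ : ∀ y → ¬ OnTheta′ y → ∃ λ e′ → M (g e′) ≡ true × Inc H e′ y
      cover′ y y-off with special? (f⁻¹ y)
      ... | yes s = subst (λ y → ∃ λ e′ → M (g e′) ≡ true × Inc H e′ y) c≡y
                      (cover-c (λ k → y-off (subst OnTheta′ c≡y k)))
        where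
        c≡y : c ≡ y
        c≡y = trans (sym (f-special s)) (f∘f⁻¹ y)
      ... | no ¬s = cover-nonspecial y y-off ¬s

      specials-coincide : ∀ {x x′} → OnTheta x → OnTheta x′ → Special x → Special x′ → x ≡ x′
      specials-coincide kx kx′ sx sx′ = f-injective-onTheta kx kx′ (trans (f-special sx) (sym (f-special sx′)))

      theta : WalkTheta H
      theta = assemble I₁ I₂ I₃ (λ eq → a≢b (f-injective-onTheta (inj₁ (start∈ W₁)) (inj₁ (end∈ W₁)) eq))
        (λ p q sx sx′ x≢x′ → ⊥-elim (x≢x′ (specials-coincide (inj₁ p) (inj₂ (inj₁ q)) sx sx′)))
        (λ p q sx sx′ x≢x′ → ⊥-elim (x≢x′ (specials-coincide (inj₁ p) (inj₂ (inj₂ q)) sx sx′)))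
        (λ p q sx sx′ x≢x′ → ⊥-elim (x≢x′ (specials-coincide (inj₂ (inj₁ p)) (inj₂ (inj₂ q)) sx sx′)))
        record { M = λ e′ → M (g e′)
               ; avoid = λ e′ m → avoid′ (inj₁ refl) m , avoid′ (inj₂ refl) m
               ; cover = cover′
               ; unique = unique-via-g matched-special-end }

    -- W₁ runs A v₁ v₀ v₂ B; contracting e₁ and e₂ glues the images of A and B at c.
    module V₀Inside (v₀≢a : v₀ ≢ a) (v₀≢b : v₀ ≢ b) (D : SplitAt W₁ v₀)
                    (e⁻≡e₁ : SplitAt.e⁻ D ≡ e₁) (e⁺≡e₂ : SplitAt.e⁺ D ≡ e₂) where
      open SplitAt D

      p≡v₁ : p ≡ v₁
      p≡v₁ = joins-other-end (subst (λ z → Joins G z p v₀) e⁻≡e₁ joins⁻) joins₁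

      s≡v₂ : s ≡ v₂
      s≡v₂ = sym (joins-other-end (joins-sym joins₂) (subst (λ z → Joins G z v₀ s) e⁺≡e₂ joins⁺))

      distinct-split : Distinct (frontVertices A ++ p ∷ v₀ ∷ vertices B)
      distinct-split = subst Distinct vertices-split distinct₁

      distinct-front-A : Distinct (frontVertices A)
      distinct-front-A = proj₁ (distinct-++⁻ (frontVertices A) _ distinct-split)

      p∉ : p ∉ v₀ ∷ vertices B
      p∉ = proj₁ (proj₁ (proj₂ (distinct-++⁻ (frontVertices A) _ distinct-split)))

      v₀∉B : v₀ ∉ vertices B
      v₀∉B = proj₁ (proj₂ (proj₁ (proj₂ (distinct-++⁻ (frontVertices A) _ distinct-split))))

      distinct-B : Distinct (vertices B)
      distinct-B = proj₂ (proj₂ (proj₁ (proj₂ (distinct-++⁻ (frontVertices A) _ distinct-split))))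

      front-A-apart : ∀ {x} → x ∈ frontVertices A → x ∉ p ∷ v₀ ∷ vertices B
      front-A-apart = proj₂ (proj₂ (distinct-++⁻ (frontVertices A) _ distinct-split))

      distinct-A : Distinct (vertices A)
      distinct-A = subst Distinct (sym (vertices-front A))
        (proj₁ (distinct-++⁻ (frontVertices A ++ p ∷ []) _
                  (subst Distinct (sym (++-assoc (frontVertices A) (p ∷ []) (v₀ ∷ vertices B))) distinct-split)))

      ∈A⁻ : ∀ {x} → x ∈ vertices A → x ∈ frontVertices A ⊎ x ≡ p
      ∈A⁻ m with ∈-++⁻ (frontVertices A) (subst (_ ∈_) (vertices-front A) m)
      ... | inj₁ q        = inj₁ q
      ... | inj₂ (here q) = inj₂ q

      v₀∉A : v₀ ∉ vertices A
      v₀∉A m with ∈A⁻ m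
      ... | inj₁ q = front-A-apart q (there (here refl))
      ... | inj₂ q = v₀≢v₁ (trans q p≡v₁)

      A-B-apart : ∀ {x} → x ∈ vertices A → x ∉ vertices B
      A-B-apart m m′ with ∈A⁻ m
      ... | inj₁ q    = front-A-apart q (there (there m′))
      ... | inj₂ refl = p∉ (there m′)

      ∈W₁ : ∀ {x} → x ∈ frontVertices A ++ p ∷ v₀ ∷ vertices B → x ∈ vertices W₁
      ∈W₁ m = subst (_ ∈_) (sym vertices-split) m

      special∈W₁ : ∀ {x} → Special x → x ∈ vertices W₁
      special∈W₁ (inj₁ refl)        = ∈W₁ (∈-++⁺ʳ (frontVertices A) (there (here refl)))
      special∈W₁ (inj₂ (inj₁ refl)) = subst (_∈ vertices W₁) p≡v₁ (∈W₁ (∈-++⁺ʳ (frontVertices A) (here refl)))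
      special∈W₁ (inj₂ (inj₂ refl)) =
        subst (_∈ vertices W₁) s≡v₂ (∈W₁ (∈-++⁺ʳ (frontVertices A) (there (there (start∈ B)))))

      L₁ : List (V G)
      L₁ = frontVertices A ++ vertices B

      L₁⊆W₁ : ∀ {x} → x ∈ L₁ → x ∈ vertices W₁
      L₁⊆W₁ m with ∈-++⁻ (frontVertices A) m
      ... | inj₁ q = ∈W₁ (∈-++⁺ˡ q)
      ... | inj₂ q = ∈W₁ (∈-++⁺ʳ (frontVertices A) (there (there q)))

      ∈W₁⇒∈L₁ : ∀ {x} → x ∈ vertices W₁ → ¬ Special x → x ∈ L₁
      ∈W₁⇒∈L₁ m ¬s with ∈-++⁻ (frontVertices A) (subst (_ ∈_) vertices-split m)
      ... | inj₁ q                   = ∈-++⁺ˡ q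
      ... | inj₂ (here refl)         = ⊥-elim (¬s (inj₂ (inj₁ p≡v₁)))
      ... | inj₂ (there (here refl)) = ⊥-elim (¬s (inj₁ refl))
      ... | inj₂ (there (there q))   = ∈-++⁺ʳ (frontVertices A) q

      special∈L₁ : ∀ {x} → x ∈ L₁ → Special x → x ≡ v₂
      special∈L₁ m (inj₁ refl) with ∈-++⁻ (frontVertices A) m
      ... | inj₁ q = ⊥-elim (front-A-apart q (there (here refl)))
      ... | inj₂ q = ⊥-elim (v₀∉B q)
      special∈L₁ m (inj₂ (inj₁ refl)) with ∈-++⁻ (frontVertices A) m
      ... | inj₁ q = ⊥-elim (front-A-apart q (here (sym p≡v₁)))
      ... | inj₂ q = ⊥-elim (p∉ (there (subst (_∈ vertices B) (sym p≡v₁) q)))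
      special∈L₁ m (inj₂ (inj₂ q)) = q

      f-injective-L₁ : ∀ {x y} → x ∈ L₁ → y ∈ L₁ → f x ≡ f y → x ≡ y
      f-injective-L₁ mx my eq with f-injective eq
      ... | inj₁ q        = q
      ... | inj₂ (sx , sy) = trans (special∈L₁ mx sx) (sym (special∈L₁ my sy))

      X₁ : Walk H (f a) (f b)
      X₁ = project A v₀∉A ++ʷ cast (trans (f-special (inj₂ (inj₂ s≡v₂))) (sym (f-special (inj₂ (inj₁ p≡v₁))))) refl
                                     (project B v₀∉B)

      vertices-X₁ : vertices X₁ ≡ map f L₁
      vertices-X₁ = begin
          vertices X₁
        ≡⟨ vertices-++ (project A v₀∉A) _ ⟩
          frontVertices (project A v₀∉A) ++ vertices (cast _ refl (project B v₀∉B))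
        ≡⟨ cong₂ _++_ (project-frontVertices A v₀∉A)
                      (trans (vertices-cast _ refl (project B v₀∉B)) (project-vertices B v₀∉B)) ⟩
          map f (frontVertices A) ++ map f (vertices B)
        ≡⟨ map-++ f (frontVertices A) (vertices B) ⟨
          map f L₁ ∎
        where open ≡-Reasoning

      edges-X₁ : edges X₁ ≡ edges (project A v₀∉A) ++ edges (project B v₀∉B)
      edges-X₁ = trans (edges-++ (project A v₀∉A) _)
                       (cong (edges (project A v₀∉A) ++_) (edges-cast _ refl (project B v₀∉B)))

      edge∈W₁ : ∀ {e′} → e′ ∈ edges X₁ → g e′ ∈ edges W₁
      edge∈W₁ m with ∈-++⁻ (edges (project A v₀∉A)) (subst (_ ∈_) edges-X₁ m)
      ... | inj₁ q = subst (_ ∈_) (sym edges-split) (∈-++⁺ˡ (project-edge∈ A v₀∉A q))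
      ... | inj₂ q = subst (_ ∈_) (sym edges-split) (∈-++⁺ʳ (edges A) (there (there (project-edge∈ B v₀∉B q))))

      length-W₁ : walkLength W₁ ≡ suc (suc (walkLength A + walkLength B))
      length-W₁ = trans (cong length edges-split)
                        (trans (length-++ (edges A)) (+-suc-suc (walkLength A) (walkLength B)))

      length-X₁ : walkLength X₁ ≡ walkLength A + walkLength B
      length-X₁ = trans (cong length edges-X₁)
        (trans (length-++ (edges (project A v₀∉A))) (cong₂ _+_ (project-length A v₀∉A) (project-length B v₀∉B)))

      I₁ : Projected W₁
      I₁ = record
        { X = X₁ ; L = L₁ ; vertices-X = vertices-X₁ ; L⊆W = L₁⊆W₁
        ; distinct = subst Distinct (sym vertices-X₁)
            (distinct-map⁺ f L₁ (distinct-++⁺ (frontVertices A) (vertices B) distinct-front-A distinct-B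
                                   (λ m m′ → front-A-apart m (there (there m′))))
                             f-injective-L₁)
        ; odd = subst Odd (sym length-X₁) (odd-suc-suc⁻ _ (subst Odd length-W₁ odd₁))
        ; edge∈W = edge∈W₁ }

      -- Otherwise W₁ would be a v₀ b, of even length 2, or B would revisit the start of A.
      v₁v₂-not-both-ends : (v₁ ≡ a ⊎ v₁ ≡ b) → (v₂ ≡ a ⊎ v₂ ≡ b) → ⊥
      v₁v₂-not-both-ends (inj₁ v₁≡a) (inj₁ v₂≡a) = v₁≢v₂ (trans v₁≡a (sym v₂≡a))
      v₁v₂-not-both-ends (inj₂ v₁≡b) (inj₂ v₂≡b) = v₁≢v₂ (trans v₁≡b (sym v₂≡b))
      v₁v₂-not-both-ends (inj₁ v₁≡a) (inj₂ v₂≡b) with odd-suc-suc⁻ 0 (subst Odd length-W₁′ odd₁)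
        where
        length-W₁′ : walkLength W₁ ≡ 2
        length-W₁′ = trans length-W₁ (cong₂ (λ m n → suc (suc (m + n)))
          (closed-distinct⇒length0 A (trans (sym v₁≡a) (sym p≡v₁)) distinct-A)
          (closed-distinct⇒length0 B (trans s≡v₂ v₂≡b) distinct-B))
      ... | k , ()
      v₁v₂-not-both-ends (inj₂ v₁≡b) (inj₁ v₂≡a) =
        A-B-apart (start∈ A) (subst (_∈ vertices B) (trans s≡v₂ v₂≡a) (start∈ B))

      distinct-specials-not-both-ends : ∀ {x y} → x ≢ y → Special x → Special y → x ≢ v₀ → y ≢ v₀ →
                                        (x ≡ a ⊎ x ≡ b) → (y ≡ a ⊎ y ≡ b) → ⊥
      distinct-specials-not-both-ends x≢y (inj₁ q) _ x≢v₀ _ _ _ = x≢v₀ q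
      distinct-specials-not-both-ends x≢y _ (inj₁ q) _ y≢v₀ _ _ = y≢v₀ q
      distinct-specials-not-both-ends x≢y (inj₂ (inj₁ refl)) (inj₂ (inj₁ refl)) _ _ _ _ = x≢y refl
      distinct-specials-not-both-ends x≢y (inj₂ (inj₂ refl)) (inj₂ (inj₂ refl)) _ _ _ _ = x≢y refl
      distinct-specials-not-both-ends x≢y (inj₂ (inj₁ refl)) (inj₂ (inj₂ refl)) _ _ hx hy = v₁v₂-not-both-ends hx hy
      distinct-specials-not-both-ends x≢y (inj₂ (inj₂ refl)) (inj₂ (inj₁ refl)) _ _ hx hy = v₁v₂-not-both-ends hy hx

      module OtherWalk (W : Walk G a b) (d : Distinct (vertices W)) (o : Odd (walkLength W))
                       (meet : MeetAtEnds W₁ W) where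
        v₀∉W : v₀ ∉ vertices W
        v₀∉W m with meet (special∈W₁ (inj₁ refl)) m
        ... | inj₁ q = v₀≢a q
        ... | inj₂ q = v₀≢b q

        f-injective-W : ∀ {x y} → x ∈ vertices W → y ∈ vertices W → f x ≡ f y → x ≡ y
        f-injective-W {x} {y} mx my eq with x ≟ y
        ... | yes q = q
        ... | no x≢y with f-injective eq
        ... | inj₁ q = q
        ... | inj₂ (sx , sy) = ⊥-elim (distinct-specials-not-both-ends x≢y sx sy
                                 (λ q → v₀∉W (subst (_∈ vertices W) q mx)) (λ q → v₀∉W (subst (_∈ vertices W) q my))
                                 (meet (special∈W₁ sx) mx) (meet (special∈W₁ sy) my))

        projected : Projected W
        projected = record
          { X = project W v₀∉W ; L = vertices W ; vertices-X = project-vertices W v₀∉W ; L⊆W = λ m → m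
          ; distinct = subst Distinct (sym (project-vertices W v₀∉W)) (distinct-map⁺ f (vertices W) d f-injective-W)
          ; odd = subst Odd (sym (project-length W v₀∉W)) o
          ; edge∈W = project-edge∈ W v₀∉W }

        specials-meet : ∀ {W′} → SpecialMeetsAtEnds W′ W
        specials-meet _ x′∈ _ sx′ _ = ⊎-map (cong f) (cong f) (meet (special∈W₁ sx′) x′∈)

      module O₂ = OtherWalk W₂ distinct₂ odd₂ meet₁₂
      module O₃ = OtherWalk W₃ distinct₃ odd₃ meet₁₃

      OnTheta′ : V H → Set
      OnTheta′ = OnWalks X₁ (X O₂.projected) (X O₃.projected)

      avoid′ : ∀ {e′ y} → Inc H e′ y → M (g e′) ≡ true → ¬ OnTheta′ y
      avoid′ i m k with inc-H⇒G i | onProjected⁻ {I₁} {O₂.projected} {O₃.projected} k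
      ... | z , iz , refl | x , kx , eq with f-injective eq
      ... | inj₁ refl     = matched⇒offTheta m iz kx
      ... | inj₂ (sz , _) = matched⇒offTheta m iz (inj₁ (special∈W₁ sz))

      onTheta⇒onTheta′ : ∀ {x} → OnTheta x → ¬ Special x → OnTheta′ (f x)
      onTheta⇒onTheta′ (inj₁ m) ¬s = inj₁ (subst (_ ∈_) (sym vertices-X₁) (∈-map⁺ f (∈W₁⇒∈L₁ m ¬s)))
      onTheta⇒onTheta′ (inj₂ (inj₁ m)) _ = inj₂ (inj₁ (subst (_ ∈_) (sym (project-vertices W₂ O₂.v₀∉W)) (∈-map⁺ f m)))
      onTheta⇒onTheta′ (inj₂ (inj₂ m)) _ = inj₂ (inj₂ (subst (_ ∈_) (sym (project-vertices W₃ O₃.v₀∉W)) (∈-map⁺ f m)))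

      c-onTheta′ : OnTheta′ c
      c-onTheta′ = inj₁ (subst (_ ∈_) (sym vertices-X₁) (subst (_∈ map f L₁) (f-special (inj₂ (inj₂ s≡v₂)))
                                                          (∈-map⁺ f (∈-++⁺ʳ (frontVertices A) (start∈ B)))))

      off⇒nonspecial : ∀ y → ¬ OnTheta′ y → ¬ Special (f⁻¹ y)
      off⇒nonspecial y y-off s = y-off (subst OnTheta′ (trans (sym (f-special s)) (f∘f⁻¹ y)) c-onTheta′)

      cover′ : ∀ y → ¬ OnTheta′ y → ∃ λ e′ → M (g e′) ≡ true × Inc H e′ y
      cover′ y y-off
        with cover (f⁻¹ y) (λ k → y-off (subst OnTheta′ (f∘f⁻¹ y) (onTheta⇒onTheta′ k (off⇒nonspecial y y-off))))
      ... | e , me , ie = cover-nonspecial-via-g me ie (off⇒nonspecial y y-off) (f∘f⁻¹ y)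

      fa≢fb : f a ≢ f b
      fa≢fb eq with f-injective eq
      ... | inj₁ q        = a≢b q
      ... | inj₂ (sa , sb) = distinct-specials-not-both-ends a≢b sa sb (λ q → v₀≢a (sym q)) (λ q → v₀≢b (sym q))
                               (inj₁ refl) (inj₂ refl)

      theta : WalkTheta H
      theta = assemble I₁ O₂.projected O₃.projected fa≢fb O₂.specials-meet O₃.specials-meet O₃.specials-meet
        record { M = λ e′ → M (g e′)
               ; avoid = λ e′ m → avoid′ (inj₁ refl) m , avoid′ (inj₂ refl) m
               ; cover = cover′
               ; unique = unique-via-g (λ m iz sz → ⊥-elim (matched⇒offTheta m iz (inj₁ (special∈W₁ sz)))) }

module ContractionToTheta (G H : Graph) (v₀ v₁ v₂ : V G) (e₁ e₂ : E G) (v₁≢v₂ : v₁ ≢ v₂)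
                          (deg : DegreeTwo G v₀ v₁ v₂ e₁ e₂) (C : Contraction G v₀ v₁ v₂ e₁ e₂ H) where

  open Contracted G H v₀ v₁ v₂ e₁ e₂ v₁≢v₂ deg C

  module Extend (M′ : E H → Bool) where

    extend : Bool → E G → Bool
    extend with-e₂ e with e ≟ e₁ | e ≟ e₂
    ... | yes _     | _         = false
    ... | no _      | yes _     = with-e₂
    ... | no e≢e₁   | no e≢e₂   = M′ (proj₁ (g-surj e e≢e₁ e≢e₂))

    extend-g : ∀ with-e₂ e′ → extend with-e₂ (g e′) ≡ M′ e′
    extend-g with-e₂ e′ with g e′ ≟ e₁ | g e′ ≟ e₂
    ... | yes p   | _       = ⊥-elim (proj₁ (g-avoid e′) p)
    ... | no _    | yes p   = ⊥-elim (proj₂ (g-avoid e′) p)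
    ... | no e≢e₁ | no e≢e₂ = cong M′ (g-inj (proj₂ (g-surj (g e′) e≢e₁ e≢e₂)))

    extend-e₂ : ∀ with-e₂ → extend with-e₂ e₂ ≡ with-e₂
    extend-e₂ with-e₂ with e₂ ≟ e₁ | e₂ ≟ e₂
    ... | yes p | _       = ⊥-elim (e₁≢e₂ (sym p))
    ... | no _  | yes _   = refl
    ... | no _  | no e₂≢e₂ = ⊥-elim (e₂≢e₂ refl)

    extend-cases : ∀ with-e₂ e → extend with-e₂ e ≡ true →
                   (e ≡ e₂ × with-e₂ ≡ true) ⊎ ∃ λ e′ → e ≡ g e′ × M′ e′ ≡ true
    extend-cases with-e₂ e m with e ≟ e₁ | e ≟ e₂
    extend-cases with-e₂ e () | yes _ | _
    ... | no _    | yes p   = inj₁ (p , m)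
    ... | no e≢e₁ | no e≢e₂ = inj₂ (proj₁ (g-surj e e≢e₁ e≢e₂) , sym (proj₂ (g-surj e e≢e₁ e≢e₂)) , m)

  module LiftMatching (K : V G → Set) (K′ : V H → Set) (pm′ : PerfectMatchingAvoiding H K′)
                      (K⇒K′ : ∀ {x} → ¬ Special x → K x → K′ (f x))
                      (K′⇒K : ∀ {x} → ¬ Special x → K′ (f x) → K x) where
    open PerfectMatchingAvoiding pm′ renaming (M to M′; avoid to avoid′; cover to cover′; unique to unique′)
    open Extend M′

    matched⇒off′ : ∀ {e′ y} → M′ e′ ≡ true → Inc H e′ y → ¬ K′ y
    matched⇒off′ {e′} m (inj₁ refl) = proj₁ (avoid′ e′ m)
    matched⇒off′ {e′} m (inj₂ refl) = proj₂ (avoid′ e′ m)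

    lifted-end-off : (∀ {z} → Special z → ¬ K′ c → ¬ K z) →
                     ∀ {e′ z} → M′ e′ ≡ true → Inc G (g e′) z → ¬ K z
    lifted-end-off special-off {e′} {z} m i k with special? z
    ... | yes s = special-off s (matched⇒off′ m (inc-special⇒inc-c i s)) k
    ... | no ¬s = matched⇒off′ m (inc-G⇒H i) (K⇒K′ ¬s k)

    cover-nonspecial : ∀ with-e₂ {x} → ¬ Special x → ¬ K x → ∃ λ e → extend with-e₂ e ≡ true × Inc G e x
    cover-nonspecial with-e₂ {x} ¬s x-off with cover′ (f x) (λ k′ → x-off (K′⇒K ¬s k′))
    ... | e′ , m , i with inc-H⇒G i
    ... | z , iz , fz with f-injective fz
    ... | inj₁ refl    = g e′ , trans (extend-g with-e₂ e′) m , iz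
    ... | inj₂ (_ , s) = ⊥-elim (¬s s)

    unique-lifted : ∀ with-e₂ x e′ e″ → extend with-e₂ (g e′) ≡ true → extend with-e₂ (g e″) ≡ true →
                    Inc G (g e′) x → Inc G (g e″) x → g e′ ≡ g e″
    unique-lifted with-e₂ x e′ e″ m′ m″ i′ i″ =
      cong g (unique′ (f x) e′ e″ (trans (sym (extend-g with-e₂ e′)) m′) (trans (sym (extend-g with-e₂ e″)) m″)
                      (inc-G⇒H i′) (inc-G⇒H i″))

    -- A matched edge at v₂ would also be the matched edge at c, i.e. the lifted edge covering v₁.
    lifted-avoids-v₂ : (K v₁ → K′ c) → (¬ K v₁ → ∃ λ e′ → M′ e′ ≡ true × Inc G (g e′) v₁) →
                       ∀ e′ → M′ e′ ≡ true → ¬ Inc G (g e′) v₂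
    lifted-avoids-v₂ v₁-on⇒c-on v₁-covered e′ m at-v₂
      with v₁-covered (λ k → matched⇒off′ m (inc-special⇒inc-c at-v₂ (inj₂ (inj₂ refl))) (v₁-on⇒c-on k))
    ... | e″ , m″ , at-v₁ with unique′ c e′ e″ m m″ (inc-special⇒inc-c at-v₂ (inj₂ (inj₂ refl)))
                                                    (inc-special⇒inc-c at-v₁ (inj₂ (inj₁ refl)))
    ... | refl = v₁≢v₂ (special-end-unique at-v₁ at-v₂ (inj₂ (inj₁ refl)) (inj₂ (inj₂ refl)))

    lift-covering-specials : (∀ {x} → Special x → K x) → K′ c → PerfectMatchingAvoiding G K
    lift-covering-specials specials-on c-on = record
      { M = extend false ; avoid = avoid″ ; cover = cover″ ; unique = unique″ }
      where
      avoid″ : ∀ e → extend false e ≡ true → ¬ K (src G e) × ¬ K (tgt G e)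
      avoid″ e m with extend-cases false e m
      ... | inj₁ (_ , ())
      ... | inj₂ (e′ , refl , m′) = lifted-end-off special-off m′ (inj₁ refl) , lifted-end-off special-off m′ (inj₂ refl)
        where
        special-off : ∀ {z} → Special z → ¬ K′ c → ¬ K z
        special-off _ c-off _ = c-off c-on
      cover″ : ∀ x → ¬ K x → ∃ λ e → extend false e ≡ true × Inc G e x
      cover″ x x-off with special? x
      ... | yes s = ⊥-elim (x-off (specials-on s))
      ... | no ¬s = cover-nonspecial false ¬s x-off
      unique″ : ∀ x e e″ → extend false e ≡ true → extend false e″ ≡ true → Inc G e x → Inc G e″ x → e ≡ e″
      unique″ x e e″ m m″ i i″ with extend-cases false e m | extend-cases false e″ m″
      ... | inj₁ (_ , ()) | _
      ... | inj₂ _ | inj₁ (_ , ())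
      ... | inj₂ (e′ , refl , _) | inj₂ (e‴ , refl , _) = unique-lifted false x e′ e‴ m m″ i i″

    lift-adding-e₂ : ¬ K v₀ → ¬ K v₂ → (K v₁ → K′ c) →
                     (¬ K v₁ → ∃ λ e′ → M′ e′ ≡ true × Inc G (g e′) v₁) → PerfectMatchingAvoiding G K
    lift-adding-e₂ v₀-off v₂-off v₁-on⇒c-on v₁-covered = record
      { M = extend true ; avoid = avoid″ ; cover = cover″ ; unique = unique″ }
      where
      special-off : ∀ {z} → Special z → ¬ K′ c → ¬ K z
      special-off (inj₁ refl)        _     = v₀-off
      special-off (inj₂ (inj₁ refl)) c-off = λ k → c-off (v₁-on⇒c-on k)
      special-off (inj₂ (inj₂ refl)) _     = v₂-off
      e₂-end-off : ∀ {z} → Inc G e₂ z → ¬ K z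
      e₂-end-off i with inc-joins joins₂ i
      ... | inj₁ refl = v₀-off
      ... | inj₂ refl = v₂-off
      avoid″ : ∀ e → extend true e ≡ true → ¬ K (src G e) × ¬ K (tgt G e)
      avoid″ e m with extend-cases true e m
      ... | inj₁ (refl , _)       = e₂-end-off (inj₁ refl) , e₂-end-off (inj₂ refl)
      ... | inj₂ (e′ , refl , m′) =
        lifted-end-off special-off m′ (inj₁ refl) , lifted-end-off special-off m′ (inj₂ refl)
      cover″ : ∀ x → ¬ K x → ∃ λ e → extend true e ≡ true × Inc G e x
      cover″ x x-off with special? x
      ... | yes (inj₁ refl)        = e₂ , extend-e₂ true , joins⇒inc₁ joins₂
      ... | yes (inj₂ (inj₂ refl)) = e₂ , extend-e₂ true , joins⇒inc₂ joins₂
      ... | yes (inj₂ (inj₁ refl)) with v₁-covered x-off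
      ... | e′ , m , i = g e′ , trans (extend-g true e′) m , i
      cover″ x x-off | no ¬s = cover-nonspecial true ¬s x-off
      e₂-lifted-apart : ∀ x e′ → M′ e′ ≡ true → Inc G e₂ x → Inc G (g e′) x → ⊥
      e₂-lifted-apart x e′ m i i′ with inc-joins joins₂ i
      ... | inj₁ refl = g-avoids-v₀ e′ i′
      ... | inj₂ refl = lifted-avoids-v₂ v₁-on⇒c-on v₁-covered e′ m i′
      unique″ : ∀ x e e″ → extend true e ≡ true → extend true e″ ≡ true → Inc G e x → Inc G e″ x → e ≡ e″
      unique″ x e e″ m m″ i i″ with extend-cases true e m | extend-cases true e″ m″
      ... | inj₁ (refl , _)       | inj₁ (refl , _)       = refl
      ... | inj₁ (refl , _)       | inj₂ (e‴ , refl , m‴) = ⊥-elim (e₂-lifted-apart x e‴ m‴ i i″)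
      ... | inj₂ (e′ , refl , m′) | inj₁ (refl , _)       = ⊥-elim (e₂-lifted-apart x e′ m′ i″ i)
      ... | inj₂ (e′ , refl , _)  | inj₂ (e‴ , refl , _)  = unique-lifted true x e′ e‴ m m″ i i″

  record FirstStep {u w : V H} (W′ : Walk H u w) : Set where
    field
      e′       : E H
      s′       : V H
      joins′   : Joins H e′ u s′
      B′       : Walk H s′ w
      vertices-step : vertices W′ ≡ u ∷ vertices B′
      edges-step    : edges W′ ≡ e′ ∷ edges B′
      z        : V G
      f-z      : f z ≡ u
      joins-z  : Joins G (g e′) z (f⁻¹ s′)

  firstStep : ∀ {u w} (W′ : Walk H u w) → u ≢ w → u ≡ c → Distinct (vertices W′) → FirstStep W′
  firstStep [] u≢w _ _ = ⊥-elim (u≢w refl)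
  firstStep (step e′ j′ B′) _ u≡c (u∉ , _) with joins-H⇒G j′
  ... | s , t , J , fs , ft = record
    { e′ = e′ ; s′ = _ ; joins′ = j′ ; B′ = B′ ; vertices-step = refl ; edges-step = refl
    ; z = s ; f-z = fs
    ; joins-z = subst (Joins G (g e′) s) (trans (sym (f⁻¹∘f ¬st)) (cong f⁻¹ ft)) J }
    where
    ¬st : ¬ Special t
    ¬st st = u∉ (subst (_∈ vertices B′) (sym (trans u≡c (trans (sym (f-special st)) ft))) (start∈ B′))

  firstStep-special : ∀ {u w} {W′ : Walk H u w} (S : FirstStep W′) → u ≡ c →
                      FirstStep.z S ≡ v₁ ⊎ FirstStep.z S ≡ v₂
  firstStep-special S u≡c with f≡c⇒special (trans (FirstStep.f-z S) u≡c)
  ... | inj₁ q = ⊥-elim (g-avoids-v₀ (FirstStep.e′ S) (subst (Inc G _) q (joins⇒inc₁ (FirstStep.joins-z S))))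
  ... | inj₂ r = r

  module _ (T′ : WalkTheta H) where
    open WalkTheta T′ renaming (a to a′; b to b′; a≢b to a′≢b′; W₁ to W₁′; W₂ to W₂′; W₃ to W₃′;
      distinct₁ to distinct₁′; distinct₂ to distinct₂′; distinct₃ to distinct₃′;
      odd₁ to odd₁′; odd₂ to odd₂′; odd₃ to odd₃′; meet₁₂ to meet₁₂′; meet₁₃ to meet₁₃′; meet₂₃ to meet₂₃′;
      apart₁₂ to apart₁₂′; apart₁₃ to apart₁₃′; apart₂₃ to apart₂₃′; conformal to conformal′)

    OnTheta′ : V H → Set
    OnTheta′ = OnWalks W₁′ W₂′ W₃′

    record Lifted (a b : V G) (W′ : Walk H a′ b′) : Set where
      field
        X        : Walk G a b
        distinct : Distinct (vertices X)
        odd      : Odd (walkLength X)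
        ∈X⁻      : ∀ {x} → x ∈ vertices X → Special x ⊎ ∃ λ y → y ∈ vertices W′ × y ≢ c × x ≡ f⁻¹ y
        ∈X⁺      : ∀ {y} → y ∈ vertices W′ → y ≢ c → f⁻¹ y ∈ vertices X
        edge∈X⁻  : ∀ {e} → e ∈ edges X → (e ≡ e₁ ⊎ e ≡ e₂) ⊎ ∃ λ e′ → e′ ∈ edges W′ × e ≡ g e′

    open Lifted

    module Assemble (a b : V G) (a-lifts : a′ ≢ c → f⁻¹ a′ ≡ a) (b-lifts : b′ ≢ c → f⁻¹ b′ ≡ b)
                    (a≢b : a ≢ b) (v₀≢a : v₀ ≢ a) (v₀≢b : v₀ ≢ b)
                    (L₁ : Lifted a b W₁′) (L₂ : Lifted a b W₂′) (L₃ : Lifted a b W₃′) where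

      OnTheta : V G → Set
      OnTheta = OnWalks (X L₁) (X L₂) (X L₃)

      SpecialMeetsAtEnds : ∀ {W W′} → Lifted a b W → Lifted a b W′ → Set
      SpecialMeetsAtEnds L L′ = ∀ {x} → Special x → x ∈ vertices (X L) → x ∈ vertices (X L′) → x ≡ a ⊎ x ≡ b

      lifted-meet : ∀ {W W′} (L : Lifted a b W) (L′ : Lifted a b W′) → MeetAtEnds W W′ →
                    SpecialMeetsAtEnds L L′ → MeetAtEnds (X L) (X L′)
      lifted-meet L L′ meet special {x} m m′ with special? x
      ... | yes s = special s m m′
      ... | no ¬s with ∈X⁻ L m | ∈X⁻ L′ m′
      ... | inj₁ s | _ = ⊥-elim (¬s s)
      ... | inj₂ _ | inj₁ s = ⊥-elim (¬s s)
      ... | inj₂ (y , y∈ , y≢c , refl) | inj₂ (y′ , y′∈ , _ , eq) with f⁻¹-injective eq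
      ... | refl = ⊎-map (λ { refl → a-lifts y≢c }) (λ { refl → b-lifts y≢c }) (meet y∈ y′∈)

      lifted-apart : ∀ {W W′} (L : Lifted a b W) (L′ : Lifted a b W′) → SpecialMeetsAtEnds L L′ →
                     EdgeDisjoint W W′ → EdgeDisjoint (X L) (X L′)
      lifted-apart L L′ special apart {e} m m′ with edge∈X⁻ L m | edge∈X⁻ L′ m′
      ... | inj₁ s | inj₁ _ with special (inj₁ refl) (special-edge⇒v₀∈ (X L) m s) (special-edge⇒v₀∈ (X L′) m′ s)
      ... | inj₁ q = v₀≢a q
      ... | inj₂ q = v₀≢b q
      lifted-apart L L′ special apart m m′ | inj₁ (inj₁ refl) | inj₂ (e′ , _ , q) = proj₁ (g-avoid e′) (sym q)
      lifted-apart L L′ special apart m m′ | inj₁ (inj₂ refl) | inj₂ (e′ , _ , q) = proj₂ (g-avoid e′) (sym q)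
      lifted-apart L L′ special apart m m′ | inj₂ (e′ , _ , q) | inj₁ (inj₁ refl) = proj₁ (g-avoid e′) (sym q)
      lifted-apart L L′ special apart m m′ | inj₂ (e′ , _ , q) | inj₁ (inj₂ refl) = proj₂ (g-avoid e′) (sym q)
      lifted-apart L L′ special apart m m′ | inj₂ (e′ , e′∈ , refl) | inj₂ (e″ , e″∈ , q) with g-inj q
      ... | refl = apart e′∈ e″∈

      onTheta⇒onTheta′ : ∀ {x} → ¬ Special x → OnTheta x → OnTheta′ (f x)
      onTheta⇒onTheta′ ¬s = ⊎-map (on L₁) (⊎-map (on L₂) (on L₃))
        where
        on : ∀ {W} (L : Lifted a b W) → _ ∈ vertices (X L) → f _ ∈ vertices W
        on L m with ∈X⁻ L m
        ... | inj₁ s = ⊥-elim (¬s s)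
        ... | inj₂ (y , y∈ , _ , refl) = subst (_∈ _) (sym (f∘f⁻¹ y)) y∈

      onTheta′⇒onTheta : ∀ {x} → ¬ Special x → OnTheta′ (f x) → OnTheta x
      onTheta′⇒onTheta {x} ¬s = ⊎-map (on L₁) (⊎-map (on L₂) (on L₃))
        where
        on : ∀ {W} (L : Lifted a b W) → f x ∈ vertices W → x ∈ vertices (X L)
        on L m = subst (_∈ _) (f⁻¹∘f ¬s) (∈X⁺ L m (λ q → ¬s (f≡c⇒special q)))

      open LiftMatching OnTheta OnTheta′ conformal′ onTheta⇒onTheta′ onTheta′⇒onTheta public

      assemble : SpecialMeetsAtEnds L₁ L₂ → SpecialMeetsAtEnds L₁ L₃ → SpecialMeetsAtEnds L₂ L₃ →
                 PerfectMatchingAvoiding G OnTheta → WalkTheta G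
      assemble s₁₂ s₁₃ s₂₃ pm = record
        { a = a ; b = b ; a≢b = a≢b
        ; W₁ = X L₁ ; W₂ = X L₂ ; W₃ = X L₃
        ; distinct₁ = distinct L₁ ; distinct₂ = distinct L₂ ; distinct₃ = distinct L₃
        ; odd₁ = odd L₁ ; odd₂ = odd L₂ ; odd₃ = odd L₃
        ; meet₁₂ = lifted-meet L₁ L₂ meet₁₂′ s₁₂ ; meet₁₃ = lifted-meet L₁ L₃ meet₁₃′ s₁₃
        ; meet₂₃ = lifted-meet L₂ L₃ meet₂₃′ s₂₃
        ; apart₁₂ = lifted-apart L₁ L₂ s₁₂ apart₁₂′ ; apart₁₃ = lifted-apart L₁ L₃ s₁₃ apart₁₃′
        ; apart₂₃ = lifted-apart L₂ L₃ s₂₃ apart₂₃′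
        ; conformal = pm }

    liftPath : (W′ : Walk H a′ b′) (c∉ : c ∉ vertices W′) → Distinct (vertices W′) → Odd (walkLength W′) →
               Lifted (f⁻¹ a′) (f⁻¹ b′) W′
    liftPath W′ c∉ d o = record
      { X = lift W′ c∉
      ; distinct = subst Distinct (sym (lift-vertices W′ c∉))
                     (distinct-map⁺ f⁻¹ (vertices W′) d (λ _ _ eq → f⁻¹-injective eq))
      ; odd = subst Odd (sym (lift-length W′ c∉)) o
      ; ∈X⁻ = ∈X⁻′
      ; ∈X⁺ = λ m _ → subst (_ ∈_) (sym (lift-vertices W′ c∉)) (∈-map⁺ f⁻¹ m)
      ; edge∈X⁻ = λ m → inj₂ (∈-map⁻ g (subst (_ ∈_) (lift-edges W′ c∉) m)) }
      where
      ∈X⁻′ : ∀ {x} → x ∈ vertices (lift W′ c∉) → Special x ⊎ ∃ λ y → y ∈ vertices W′ × y ≢ c × x ≡ f⁻¹ y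
      ∈X⁻′ m with ∈-map⁻ f⁻¹ (subst (_ ∈_) (lift-vertices W′ c∉) m)
      ... | y , y∈ , refl = inj₂ (y , y∈ , (λ q → c∉ (subst (_∈ _) q y∈)) , refl)

    lift-nonspecial : (W′ : Walk H a′ b′) (c∉ : c ∉ vertices W′) → ∀ {x} → x ∈ vertices (lift W′ c∉) → ¬ Special x
    lift-nonspecial W′ c∉ m = ∈map-f⁻¹⇒nonspecial c∉ (subst (_ ∈_) (lift-vertices W′ c∉) m)

    module COffTheta (c∉W₁′ : c ∉ vertices W₁′) (c∉W₂′ : c ∉ vertices W₂′) (c∉W₃′ : c ∉ vertices W₃′)
                     (e′ : E H) (e′-matched : PerfectMatchingAvoiding.M conformal′ e′ ≡ true)
                     (g-e′-at-v₁ : Inc G (g e′) v₁) where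

      a′≢c : a′ ≢ c
      a′≢c q = c∉W₁′ (subst (_∈ _) q (start∈ W₁′))

      b′≢c : b′ ≢ c
      b′≢c q = c∉W₁′ (subst (_∈ _) q (end∈ W₁′))

      open Assemble (f⁻¹ a′) (f⁻¹ b′) (λ _ → refl) (λ _ → refl) (λ eq → a′≢b′ (f⁻¹-injective eq))
                    (λ q → f⁻¹-nonspecial a′≢c (subst Special q (inj₁ refl)))
                    (λ q → f⁻¹-nonspecial b′≢c (subst Special q (inj₁ refl)))
                    (liftPath W₁′ c∉W₁′ distinct₁′ odd₁′) (liftPath W₂′ c∉W₂′ distinct₂′ odd₂′)
                    (liftPath W₃′ c∉W₃′ distinct₃′ odd₃′)

      onTheta⇒nonspecial : ∀ {x} → OnTheta x → ¬ Special x
      onTheta⇒nonspecial (inj₁ m)        = lift-nonspecial W₁′ c∉W₁′ m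
      onTheta⇒nonspecial (inj₂ (inj₁ m)) = lift-nonspecial W₂′ c∉W₂′ m
      onTheta⇒nonspecial (inj₂ (inj₂ m)) = lift-nonspecial W₃′ c∉W₃′ m

      theta : WalkTheta G
      theta = assemble (λ s m _ → ⊥-elim (lift-nonspecial W₁′ c∉W₁′ m s))
                       (λ s m _ → ⊥-elim (lift-nonspecial W₁′ c∉W₁′ m s))
                       (λ s m _ → ⊥-elim (lift-nonspecial W₂′ c∉W₂′ m s))
                       (lift-adding-e₂ (λ k → onTheta⇒nonspecial k (inj₁ refl))
                                       (λ k → onTheta⇒nonspecial k (inj₂ (inj₂ refl)))
                                       (λ k → ⊥-elim (onTheta⇒nonspecial k (inj₂ (inj₁ refl))))
                                       (λ _ → e′ , e′-matched , g-e′-at-v₁))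

    module CInside (c≢a′ : c ≢ a′) (c≢b′ : c ≢ b′) (D′ : SplitAt W₁′ c)
                   (joins-in : Joins G (g (SplitAt.e⁻ D′)) (f⁻¹ (SplitAt.p D′)) v₁) where
      open SplitAt D′ renaming (p to p′; s to s′; e⁻ to e⁻′; e⁺ to e⁺′; A to A′; B to B′)

      distinct-split : Distinct (frontVertices A′ ++ p′ ∷ c ∷ vertices B′)
      distinct-split = subst Distinct vertices-split distinct₁′

      distinct-front-A′ : Distinct (frontVertices A′)
      distinct-front-A′ = proj₁ (distinct-++⁻ (frontVertices A′) _ distinct-split)

      p′∉ : p′ ∉ c ∷ vertices B′
      p′∉ = proj₁ (proj₁ (proj₂ (distinct-++⁻ (frontVertices A′) _ distinct-split)))

      c∉B′ : c ∉ vertices B′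
      c∉B′ = proj₁ (proj₂ (proj₁ (proj₂ (distinct-++⁻ (frontVertices A′) _ distinct-split))))

      distinct-B′ : Distinct (vertices B′)
      distinct-B′ = proj₂ (proj₂ (proj₁ (proj₂ (distinct-++⁻ (frontVertices A′) _ distinct-split))))

      front-A′-apart : ∀ {y} → y ∈ frontVertices A′ → y ∉ p′ ∷ c ∷ vertices B′
      front-A′-apart = proj₂ (proj₂ (distinct-++⁻ (frontVertices A′) _ distinct-split))

      p′≢c : p′ ≢ c
      p′≢c q = p′∉ (here q)

      c∉A′ : c ∉ vertices A′
      c∉A′ m with ∈-++⁻ (frontVertices A′) (subst (_ ∈_) (vertices-front A′) m)
      ... | inj₁ q        = front-A′-apart q (there (here refl))
      ... | inj₂ (here q) = p′≢c (sym q)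

      W₁′∖c : List (V H)
      W₁′∖c = frontVertices A′ ++ p′ ∷ vertices B′

      distinct-W₁′∖c : Distinct W₁′∖c
      distinct-W₁′∖c = distinct-++⁺ (frontVertices A′) (p′ ∷ vertices B′) distinct-front-A′
                                     ((λ m → p′∉ (there m)) , distinct-B′) apart
        where
        apart : ∀ {y} → y ∈ frontVertices A′ → y ∉ p′ ∷ vertices B′
        apart m (here q)  = front-A′-apart m (here q)
        apart m (there q) = front-A′-apart m (there (there q))

      c∉W₁′∖c : c ∉ W₁′∖c
      c∉W₁′∖c m with ∈-++⁻ (frontVertices A′) m
      ... | inj₁ q         = front-A′-apart q (there (here refl))
      ... | inj₂ (here q)  = p′≢c (sym q)
      ... | inj₂ (there q) = c∉B′ q

      ∈W₁′ : ∀ {y} → y ∈ frontVertices A′ ++ p′ ∷ c ∷ vertices B′ → y ∈ vertices W₁′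
      ∈W₁′ = subst (_ ∈_) (sym vertices-split)

      W₁′∖c⊆W₁′ : ∀ {y} → y ∈ W₁′∖c → y ∈ vertices W₁′
      W₁′∖c⊆W₁′ m with ∈-++⁻ (frontVertices A′) m
      ... | inj₁ q         = ∈W₁′ (∈-++⁺ˡ q)
      ... | inj₂ (here q)  = ∈W₁′ (∈-++⁺ʳ (frontVertices A′) (here q))
      ... | inj₂ (there q) = ∈W₁′ (∈-++⁺ʳ (frontVertices A′) (there (there q)))

      ∈W₁′⇒∈W₁′∖c : ∀ {y} → y ∈ vertices W₁′ → y ≢ c → y ∈ W₁′∖c
      ∈W₁′⇒∈W₁′∖c m y≢c with ∈-++⁻ (frontVertices A′) (subst (_ ∈_) vertices-split m)
      ... | inj₁ q                 = ∈-++⁺ˡ q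
      ... | inj₂ (here q)          = ∈-++⁺ʳ (frontVertices A′) (here q)
      ... | inj₂ (there (here q))  = ⊥-elim (y≢c q)
      ... | inj₂ (there (there q)) = ∈-++⁺ʳ (frontVertices A′) (there q)

      c∈W₁′ : c ∈ vertices W₁′
      c∈W₁′ = ∈W₁′ (∈-++⁺ʳ (frontVertices A′) (there (here refl)))

      c∉other : ∀ {W′ : Walk H a′ b′} → MeetAtEnds W₁′ W′ → c ∉ vertices W′
      c∉other meet m with meet c∈W₁′ m
      ... | inj₁ q = c≢a′ q
      ... | inj₂ q = c≢b′ q

      c∉W₂′ : c ∉ vertices W₂′
      c∉W₂′ = c∉other meet₁₂′

      c∉W₃′ : c ∉ vertices W₃′
      c∉W₃′ = c∉other meet₁₃′

      length-W₁′ : walkLength W₁′ ≡ walkLength A′ + suc (suc (walkLength B′))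
      length-W₁′ = trans (cong length edges-split) (length-++ (edges A′))

      module Through (S : List (V G)) (ES : List (E G)) (MID : Walk G v₁ (f⁻¹ b′))
                     (vertices-MID : vertices MID ≡ S ++ map f⁻¹ (vertices B′))
                     (edges-MID : edges MID ≡ ES ++ g e⁺′ ∷ map g (edges B′))
                     (S-special : ∀ {x} → x ∈ S → Special x) (distinct-S : Distinct S)
                     (ES-special : ∀ {e} → e ∈ ES → e ≡ e₁ ⊎ e ≡ e₂)
                     (odd-MID : Odd (walkLength A′ + suc (length ES + suc (walkLength B′)))) where

        X₁ : Walk G (f⁻¹ a′) (f⁻¹ b′)
        X₁ = lift A′ c∉A′ ++ʷ step (g e⁻′) joins-in MID

        xs ys : List (V G)
        xs = map f⁻¹ (frontVertices A′ ++ p′ ∷ [])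
        ys = map f⁻¹ (vertices B′)

        vertices-X₁ : vertices X₁ ≡ xs ++ S ++ ys
        vertices-X₁ = begin
            vertices X₁
          ≡⟨ vertices-++ (lift A′ c∉A′) _ ⟩
            frontVertices (lift A′ c∉A′) ++ f⁻¹ p′ ∷ vertices MID
          ≡⟨ cong₂ (λ u v → u ++ f⁻¹ p′ ∷ v) (lift-frontVertices A′ c∉A′) vertices-MID ⟩
            map f⁻¹ (frontVertices A′) ++ f⁻¹ p′ ∷ (S ++ ys)
          ≡⟨ ++-assoc (map f⁻¹ (frontVertices A′)) (f⁻¹ p′ ∷ []) (S ++ ys) ⟨
            (map f⁻¹ (frontVertices A′) ++ f⁻¹ p′ ∷ []) ++ (S ++ ys)
          ≡⟨ cong (_++ (S ++ ys)) (map-++ f⁻¹ (frontVertices A′) (p′ ∷ [])) ⟨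
            xs ++ S ++ ys ∎
          where open ≡-Reasoning

        xs++ys : xs ++ ys ≡ map f⁻¹ W₁′∖c
        xs++ys = trans (sym (map-++ f⁻¹ (frontVertices A′ ++ p′ ∷ []) (vertices B′)))
                       (cong (map f⁻¹) (++-assoc (frontVertices A′) (p′ ∷ []) (vertices B′)))

        ∈X₁⇒ : ∀ {x} → x ∈ vertices X₁ → x ∈ S ⊎ x ∈ map f⁻¹ W₁′∖c
        ∈X₁⇒ m with ∈-++⁻ xs (subst (_ ∈_) vertices-X₁ m)
        ... | inj₁ q = inj₂ (subst (_ ∈_) xs++ys (∈-++⁺ˡ q))
        ... | inj₂ q with ∈-++⁻ S q
        ... | inj₁ r = inj₁ r
        ... | inj₂ r = inj₂ (subst (_ ∈_) xs++ys (∈-++⁺ʳ xs r))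

        ∈W₁′∖c⇒∈X₁ : ∀ {x} → x ∈ map f⁻¹ W₁′∖c → x ∈ vertices X₁
        ∈W₁′∖c⇒∈X₁ m with ∈-++⁻ xs (subst (_ ∈_) (sym xs++ys) m)
        ... | inj₁ q = subst (_ ∈_) (sym vertices-X₁) (∈-++⁺ˡ q)
        ... | inj₂ q = subst (_ ∈_) (sym vertices-X₁) (∈-++⁺ʳ xs (∈-++⁺ʳ S q))

        S⊆X₁ : ∀ {x} → x ∈ S → x ∈ vertices X₁
        S⊆X₁ m = subst (_ ∈_) (sym vertices-X₁) (∈-++⁺ʳ xs (∈-++⁺ˡ m))

        distinct-X₁ : Distinct (vertices X₁)
        distinct-X₁ = subst Distinct (sym vertices-X₁)
          (distinct-insert xs S ys
             (subst Distinct (sym xs++ys) (distinct-map⁺ f⁻¹ W₁′∖c distinct-W₁′∖c (λ _ _ eq → f⁻¹-injective eq)))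
             distinct-S
             (λ zS zxy → ∈map-f⁻¹⇒nonspecial c∉W₁′∖c (subst (_ ∈_) xs++ys zxy) (S-special zS)))

        special∈X₁ : ∀ {x} → x ∈ vertices X₁ → Special x → x ∈ S
        special∈X₁ m s with ∈X₁⇒ m
        ... | inj₁ q = q
        ... | inj₂ q = ⊥-elim (∈map-f⁻¹⇒nonspecial c∉W₁′∖c q s)

        edges-X₁ : edges X₁ ≡ map g (edges A′) ++ g e⁻′ ∷ ES ++ g e⁺′ ∷ map g (edges B′)
        edges-X₁ = trans (edges-++ (lift A′ c∉A′) _) (cong₂ (λ u v → u ++ g e⁻′ ∷ v) (lift-edges A′ c∉A′) edges-MID)

        length-X₁ : walkLength X₁ ≡ walkLength A′ + suc (length ES + suc (walkLength B′))
        length-X₁ = begin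
            length (edges X₁)
          ≡⟨ cong length edges-X₁ ⟩
            length (map g (edges A′) ++ g e⁻′ ∷ ES ++ g e⁺′ ∷ map g (edges B′))
          ≡⟨ length-++ (map g (edges A′)) ⟩
            length (map g (edges A′)) + suc (length (ES ++ g e⁺′ ∷ map g (edges B′)))
          ≡⟨ cong₂ (λ u v → u + suc v) (length-map g (edges A′)) (length-++ ES) ⟩
            walkLength A′ + suc (length ES + suc (length (map g (edges B′))))
          ≡⟨ cong (λ u → walkLength A′ + suc (length ES + suc u)) (length-map g (edges B′)) ⟩
            walkLength A′ + suc (length ES + suc (walkLength B′)) ∎
          where open ≡-Reasoning

        ∈W₁′-edges : ∀ {e′} → e′ ∈ edges A′ ++ e⁻′ ∷ e⁺′ ∷ edges B′ → e′ ∈ edges W₁′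
        ∈W₁′-edges = subst (_ ∈_) (sym edges-split)

        edge∈X₁⁻ : ∀ {e} → e ∈ edges X₁ → (e ≡ e₁ ⊎ e ≡ e₂) ⊎ ∃ λ e′ → e′ ∈ edges W₁′ × e ≡ g e′
        edge∈X₁⁻ m with ∈-++⁻ (map g (edges A′)) (subst (_ ∈_) edges-X₁ m)
        ... | inj₁ q with ∈-map⁻ g q
        ... | e′ , e′∈ , r = inj₂ (e′ , ∈W₁′-edges (∈-++⁺ˡ e′∈) , r)
        edge∈X₁⁻ m | inj₂ (here r) = inj₂ (e⁻′ , ∈W₁′-edges (∈-++⁺ʳ (edges A′) (here refl)) , r)
        edge∈X₁⁻ m | inj₂ (there q) with ∈-++⁻ ES q
        ... | inj₁ r = inj₁ (ES-special r)
        ... | inj₂ (here r) = inj₂ (e⁺′ , ∈W₁′-edges (∈-++⁺ʳ (edges A′) (there (here refl))) , r)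
        ... | inj₂ (there r) with ∈-map⁻ g r
        ... | e′ , e′∈ , r′ = inj₂ (e′ , ∈W₁′-edges (∈-++⁺ʳ (edges A′) (there (there e′∈))) , r′)

        ∈X₁⁻ : ∀ {x} → x ∈ vertices X₁ → Special x ⊎ ∃ λ y → y ∈ vertices W₁′ × y ≢ c × x ≡ f⁻¹ y
        ∈X₁⁻ m with ∈X₁⇒ m
        ... | inj₁ q = inj₁ (S-special q)
        ... | inj₂ q with ∈-map⁻ f⁻¹ q
        ... | y , y∈ , r = inj₂ (y , W₁′∖c⊆W₁′ y∈ , (λ eq → c∉W₁′∖c (subst (_∈ W₁′∖c) eq y∈)) , r)

        L₁ : Lifted (f⁻¹ a′) (f⁻¹ b′) W₁′
        L₁ = record
          { X = X₁ ; distinct = distinct-X₁ ; odd = subst Odd (sym length-X₁) odd-MID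
          ; ∈X⁻ = ∈X₁⁻ ; ∈X⁺ = λ m y≢c → ∈W₁′∖c⇒∈X₁ (∈-map⁺ f⁻¹ (∈W₁′⇒∈W₁′∖c m y≢c)) ; edge∈X⁻ = edge∈X₁⁻ }

        open Assemble (f⁻¹ a′) (f⁻¹ b′) (λ _ → refl) (λ _ → refl) (λ eq → a′≢b′ (f⁻¹-injective eq))
                      (λ q → f⁻¹-nonspecial (λ q′ → c≢a′ (sym q′)) (subst Special q (inj₁ refl)))
                      (λ q → f⁻¹-nonspecial (λ q′ → c≢b′ (sym q′)) (subst Special q (inj₁ refl)))
                      L₁ (liftPath W₂′ c∉W₂′ distinct₂′ odd₂′) (liftPath W₃′ c∉W₃′ distinct₃′ odd₃′) public

        special-onTheta : ∀ {x} → OnTheta x → Special x → x ∈ S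
        special-onTheta (inj₁ m)        s = special∈X₁ m s
        special-onTheta (inj₂ (inj₁ m)) s = ⊥-elim (lift-nonspecial W₂′ c∉W₂′ m s)
        special-onTheta (inj₂ (inj₂ m)) s = ⊥-elim (lift-nonspecial W₃′ c∉W₃′ m s)

        assemble′ : PerfectMatchingAvoiding G OnTheta → WalkTheta G
        assemble′ = assemble (λ s _ m′ → ⊥-elim (lift-nonspecial W₂′ c∉W₂′ m′ s))
                             (λ s _ m′ → ⊥-elim (lift-nonspecial W₃′ c∉W₃′ m′ s))
                             (λ s _ m′ → ⊥-elim (lift-nonspecial W₃′ c∉W₃′ m′ s))

      module ThroughV₁ (joins-out : Joins G (g e⁺′) v₁ (f⁻¹ s′)) where
        only-v₁ : ∀ {x} → x ∈ v₁ ∷ [] → x ≡ v₁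
        only-v₁ (here q) = q

        open Through (v₁ ∷ []) [] (step (g e⁺′) joins-out (lift B′ c∉B′))
                     (cong (v₁ ∷_) (lift-vertices B′ c∉B′)) (cong (g e⁺′ ∷_) (lift-edges B′ c∉B′))
                     (λ m → inj₂ (inj₁ (only-v₁ m))) ((λ ()) , tt) (λ ())
                     (subst Odd length-W₁′ odd₁′)

        theta : WalkTheta G
        theta = assemble′ (lift-adding-e₂ (λ k → v₀≢v₁ (only-v₁ (special-onTheta k (inj₁ refl))))
                                          (λ k → v₁≢v₂ (sym (only-v₁ (special-onTheta k (inj₂ (inj₂ refl))))))
                                          (λ _ → inj₁ c∈W₁′) (λ v₁-off → ⊥-elim (v₁-off (inj₁ (S⊆X₁ (here refl))))))

      module ThroughV₀ (joins-out : Joins G (g e⁺′) v₂ (f⁻¹ s′)) where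
        specials : List (V G)
        specials = v₁ ∷ v₀ ∷ v₂ ∷ []

        specials-special : ∀ {x} → x ∈ specials → Special x
        specials-special (here refl)                 = inj₂ (inj₁ refl)
        specials-special (there (here refl))         = inj₁ refl
        specials-special (there (there (here refl))) = inj₂ (inj₂ refl)

        special∈specials : ∀ {x} → Special x → x ∈ specials
        special∈specials (inj₁ refl)        = there (here refl)
        special∈specials (inj₂ (inj₁ refl)) = here refl
        special∈specials (inj₂ (inj₂ refl)) = there (there (here refl))

        distinct-specials : Distinct specials
        distinct-specials = v₁∉ , v₀∉ , (λ ()) , tt
          where
          v₁∉ : v₁ ∉ v₀ ∷ v₂ ∷ []
          v₁∉ (here q)         = v₀≢v₁ (sym q)
          v₁∉ (there (here q)) = v₁≢v₂ q
          v₀∉ : v₀ ∉ v₂ ∷ []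
          v₀∉ (here q) = v₀≢v₂ q

        ES-special : ∀ {e} → e ∈ e₁ ∷ e₂ ∷ [] → e ≡ e₁ ⊎ e ≡ e₂
        ES-special (here q)         = inj₁ q
        ES-special (there (here q)) = inj₂ q

        odd-MID : Odd (walkLength A′ + suc (suc (suc (suc (walkLength B′)))))
        odd-MID = subst Odd (sym (+-suc-suc (walkLength A′) (suc (suc (walkLength B′)))))
                    (odd-suc-suc⁺ _ (subst Odd length-W₁′ odd₁′))

        open Through specials (e₁ ∷ e₂ ∷ [])
                     (step e₁ (joins-sym joins₁) (step e₂ joins₂ (step (g e⁺′) joins-out (lift B′ c∉B′))))
                     (cong (λ u → v₁ ∷ v₀ ∷ v₂ ∷ u) (lift-vertices B′ c∉B′))
                     (cong (λ u → e₁ ∷ e₂ ∷ g e⁺′ ∷ u) (lift-edges B′ c∉B′))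
                     specials-special distinct-specials ES-special odd-MID

        theta : WalkTheta G
        theta = assemble′ (lift-covering-specials (λ s → inj₁ (S⊆X₁ (special∈specials s))) (inj₁ c∈W₁′))

    module FromC (a′≡c : a′ ≡ c) (W′ : Walk H a′ b′) (S : FirstStep W′)
                 (d : Distinct (vertices W′)) (o : Odd (walkLength W′)) where
      open FirstStep S

      distinct-step : Distinct (a′ ∷ vertices B′)
      distinct-step = subst Distinct vertices-step d

      c∉B′ : c ∉ vertices B′
      c∉B′ m = proj₁ distinct-step (subst (_∈ _) (sym a′≡c) m)

      distinct-lift : Distinct (vertices (lift B′ c∉B′))
      distinct-lift = subst Distinct (sym (lift-vertices B′ c∉B′))
                        (distinct-map⁺ f⁻¹ (vertices B′) (proj₂ distinct-step) (λ _ _ eq → f⁻¹-injective eq))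

      lift-nonspecial′ : ∀ {x} → x ∈ vertices (lift B′ c∉B′) → ¬ Special x
      lift-nonspecial′ m = ∈map-f⁻¹⇒nonspecial c∉B′ (subst (_ ∈_) (lift-vertices B′ c∉B′) m)

      length-step : walkLength W′ ≡ suc (walkLength (lift B′ c∉B′))
      length-step = trans (cong length edges-step) (cong suc (sym (lift-length B′ c∉B′)))

      ∈lift⁻ : ∀ {x} → x ∈ vertices (lift B′ c∉B′) → ∃ λ y → y ∈ vertices W′ × y ≢ c × x ≡ f⁻¹ y
      ∈lift⁻ m with ∈-map⁻ f⁻¹ (subst (_ ∈_) (lift-vertices B′ c∉B′) m)
      ... | y , y∈ , r = y , subst (_ ∈_) (sym vertices-step) (there y∈) , (λ q → c∉B′ (subst (_∈ _) q y∈)) , r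

      ∈lift⁺ : ∀ {y} → y ∈ vertices W′ → y ≢ c → f⁻¹ y ∈ vertices (lift B′ c∉B′)
      ∈lift⁺ m y≢c with subst (_ ∈_) vertices-step m
      ... | here q  = ⊥-elim (y≢c (trans q a′≡c))
      ... | there q = subst (_ ∈_) (sym (lift-vertices B′ c∉B′)) (∈-map⁺ f⁻¹ q)

      edge∈lift⁻ : ∀ {e} → e ∈ g e′ ∷ edges (lift B′ c∉B′) → ∃ λ e″ → e″ ∈ edges W′ × e ≡ g e″
      edge∈lift⁻ (here r) = e′ , subst (_ ∈_) (sym edges-step) (here refl) , r
      edge∈lift⁻ (there m) with ∈-map⁻ g (subst (_ ∈_) (lift-edges B′ c∉B′) m)
      ... | e″ , e″∈ , r = e″ , subst (_ ∈_) (sym edges-step) (there e″∈) , r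

      module Direct (z≡v₁ : z ≡ v₁) where
        walk : Walk G v₁ (f⁻¹ b′)
        walk = step (g e′) (subst (λ u → Joins G (g e′) u (f⁻¹ s′)) z≡v₁ joins-z) (lift B′ c∉B′)

        special∈X : ∀ {x} → x ∈ vertices walk → Special x → x ≡ v₁
        special∈X (here q)  _ = q
        special∈X (there m) s = ⊥-elim (lift-nonspecial′ m s)

        lifted : Lifted v₁ (f⁻¹ b′) W′
        lifted = record
          { X = walk
          ; distinct = (λ m → lift-nonspecial′ m (inj₂ (inj₁ refl))) , distinct-lift
          ; odd = subst Odd length-step o
          ; ∈X⁻ = λ { (here r) → inj₁ (inj₂ (inj₁ r)) ; (there m) → inj₂ (∈lift⁻ m) }
          ; ∈X⁺ = λ m y≢c → there (∈lift⁺ m y≢c)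
          ; edge∈X⁻ = λ m → inj₂ (edge∈lift⁻ m) }

      module Detour (z≡v₂ : z ≡ v₂) where
        walk : Walk G v₁ (f⁻¹ b′)
        walk = step e₁ (joins-sym joins₁) (step e₂ joins₂
              (step (g e′) (subst (λ u → Joins G (g e′) u (f⁻¹ s′)) z≡v₂ joins-z) (lift B′ c∉B′)))

        distinct-X : Distinct (vertices walk)
        distinct-X = v₁∉ , v₀∉ , (λ m → lift-nonspecial′ m (inj₂ (inj₂ refl))) , distinct-lift
          where
          v₁∉ : v₁ ∉ v₀ ∷ v₂ ∷ vertices (lift B′ c∉B′)
          v₁∉ (here q)          = v₀≢v₁ (sym q)
          v₁∉ (there (here q))  = v₁≢v₂ q
          v₁∉ (there (there m)) = lift-nonspecial′ m (inj₂ (inj₁ refl))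
          v₀∉ : v₀ ∉ v₂ ∷ vertices (lift B′ c∉B′)
          v₀∉ (here q)  = v₀≢v₂ q
          v₀∉ (there m) = lift-nonspecial′ m (inj₁ refl)

        ∈X⁻′ : ∀ {x} → x ∈ vertices walk → Special x ⊎ ∃ λ y → y ∈ vertices W′ × y ≢ c × x ≡ f⁻¹ y
        ∈X⁻′ (here r)                  = inj₁ (inj₂ (inj₁ r))
        ∈X⁻′ (there (here r))          = inj₁ (inj₁ r)
        ∈X⁻′ (there (there (here r)))  = inj₁ (inj₂ (inj₂ r))
        ∈X⁻′ (there (there (there m))) = inj₂ (∈lift⁻ m)

        edge∈X⁻′ : ∀ {e} → e ∈ edges walk → (e ≡ e₁ ⊎ e ≡ e₂) ⊎ ∃ λ e″ → e″ ∈ edges W′ × e ≡ g e″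
        edge∈X⁻′ (here r)          = inj₁ (inj₁ r)
        edge∈X⁻′ (there (here r))  = inj₁ (inj₂ r)
        edge∈X⁻′ (there (there m)) = inj₂ (edge∈lift⁻ m)

        lifted : Lifted v₁ (f⁻¹ b′) W′
        lifted = record
          { X = walk ; distinct = distinct-X ; odd = odd-suc-suc⁺ _ (subst Odd length-step o)
          ; ∈X⁻ = ∈X⁻′ ; ∈X⁺ = λ m y≢c → there (there (there (∈lift⁺ m y≢c))) ; edge∈X⁻ = edge∈X⁻′ }

        special∈X : ∀ {x} → Special x → x ∈ vertices walk
        special∈X (inj₁ refl)        = there (here refl)
        special∈X (inj₂ (inj₁ refl)) = here refl
        special∈X (inj₂ (inj₂ refl)) = there (there (here refl))

    -- Up to v₁ ↔ v₂ and renumbering, two of the first edges leave c from v₁.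
    module CEnd (a′≡c : a′ ≡ c) (S₁ : FirstStep W₁′) (S₂ : FirstStep W₂′) (S₃ : FirstStep W₃′)
                (z₁≡v₁ : FirstStep.z S₁ ≡ v₁) (z₂≡v₁ : FirstStep.z S₂ ≡ v₁) where
      module F₁ = FromC a′≡c W₁′ S₁ distinct₁′ odd₁′
      module F₂ = FromC a′≡c W₂′ S₂ distinct₂′ odd₂′
      module F₃ = FromC a′≡c W₃′ S₃ distinct₃′ odd₃′
      module D₁ = F₁.Direct z₁≡v₁
      module D₂ = F₂.Direct z₂≡v₁

      b′≢c : b′ ≢ c
      b′≢c q = a′≢b′ (trans a′≡c (sym q))

      module WithThird (L₃ : Lifted v₁ (f⁻¹ b′) W₃′) =
        Assemble v₁ (f⁻¹ b′) (λ a′≢c → ⊥-elim (a′≢c a′≡c)) (λ _ → refl)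
                 (λ q → f⁻¹-nonspecial b′≢c (subst Special q (inj₂ (inj₁ refl)))) v₀≢v₁
                 (λ q → f⁻¹-nonspecial b′≢c (subst Special q (inj₁ refl)))
                 D₁.lifted D₂.lifted L₃

      c-onTheta′ : OnTheta′ c
      c-onTheta′ = inj₁ (subst (_∈ _) a′≡c (start∈ W₁′))

      theta-third-direct : FirstStep.z S₃ ≡ v₁ → WalkTheta G
      theta-third-direct z₃≡v₁ =
        assemble (λ s m _ → inj₁ (D₁.special∈X m s)) (λ s m _ → inj₁ (D₁.special∈X m s))
                 (λ s m _ → inj₁ (D₂.special∈X m s))
                 (lift-adding-e₂ (λ k → v₀≢v₁ (special-onTheta k (inj₁ refl)))
                                 (λ k → v₁≢v₂ (sym (special-onTheta k (inj₂ (inj₂ refl)))))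
                                 (λ _ → c-onTheta′) (λ v₁-off → ⊥-elim (v₁-off (inj₁ (here refl)))))
        where
        module D₃ = F₃.Direct z₃≡v₁
        open WithThird D₃.lifted
        special-onTheta : ∀ {x} → OnTheta x → Special x → x ≡ v₁
        special-onTheta (inj₁ m)        = D₁.special∈X m
        special-onTheta (inj₂ (inj₁ m)) = D₂.special∈X m
        special-onTheta (inj₂ (inj₂ m)) = D₃.special∈X m

      theta-third-detour : FirstStep.z S₃ ≡ v₂ → WalkTheta G
      theta-third-detour z₃≡v₂ =
        assemble (λ s m _ → inj₁ (D₁.special∈X m s)) (λ s m _ → inj₁ (D₁.special∈X m s))
                 (λ s m _ → inj₁ (D₂.special∈X m s))
                 (lift-covering-specials (λ s → inj₂ (inj₂ (D₃.special∈X s))) c-onTheta′)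
        where
        module D₃ = F₃.Detour z₃≡v₂
        open WithThird D₃.lifted

module Equivalence (G H : Graph) (v₀ v₁ v₂ : V G) (e₁ e₂ : E G) (v₁≢v₂ : v₁ ≢ v₂)
                   (deg : DegreeTwo G v₀ v₁ v₂ e₁ e₂) (C : Contraction G v₀ v₁ v₂ e₁ e₂ H) where

  open Contracted G H v₀ v₁ v₂ e₁ e₂ v₁≢v₂ deg C

  private
    v₂≢v₁ : v₂ ≢ v₁
    v₂≢v₁ eq = v₁≢v₂ (sym eq)

    deg′ : DegreeTwo G v₀ v₂ v₁ e₂ e₁
    deg′ = degreeTwo-swap {G} {v₀} {v₁} {v₂} {e₁} {e₂} deg

  module TC₁ = ThetaToContraction G H v₀ v₁ v₂ e₁ e₂ v₁≢v₂ deg C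
  module TC₂ = ThetaToContraction G H v₀ v₂ v₁ e₂ e₁ v₂≢v₁ deg′ (contraction-swap C)
  module CT₁ = ContractionToTheta G H v₀ v₁ v₂ e₁ e₂ v₁≢v₂ deg C
  module CT₂ = ContractionToTheta G H v₀ v₂ v₁ e₂ e₁ v₂≢v₁ deg′ (contraction-swap C)

  theta-inside : (T : WalkTheta G) → v₀ ∈ vertices (WalkTheta.W₁ T) → WalkTheta H
  theta-inside T v₀∈ = through (splitAt v₀ W₁ v₀∈ v₀≢a v₀≢b)
    where
    open WalkTheta T
    v₀≢a : v₀ ≢ a
    v₀≢a = degree≤2-≢a T inc-v₀
    v₀≢b : v₀ ≢ b
    v₀≢b = degree≤2-≢b T inc-v₀
    through : SplitAt W₁ v₀ → WalkTheta H
    through D with inc-v₀ (SplitAt.e⁻ D) (joins⇒inc₂ (SplitAt.joins⁻ D))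
                 | inc-v₀ (SplitAt.e⁺ D) (joins⇒inc₁ (SplitAt.joins⁺ D))
    ... | inj₁ e⁻≡e₁ | inj₂ e⁺≡e₂ = TC₁.V₀Inside.theta T v₀≢a v₀≢b D e⁻≡e₁ e⁺≡e₂
    ... | inj₂ e⁻≡e₂ | inj₁ e⁺≡e₁ = TC₂.V₀Inside.theta T v₀≢a v₀≢b D e⁻≡e₂ e⁺≡e₁
    ... | inj₁ e⁻≡e₁ | inj₁ e⁺≡e₁ = ⊥-elim (split-edges-distinct distinct₁ D (trans e⁻≡e₁ (sym e⁺≡e₁)))
    ... | inj₂ e⁻≡e₂ | inj₂ e⁺≡e₂ = ⊥-elim (split-edges-distinct distinct₁ D (trans e⁻≡e₂ (sym e⁺≡e₂)))

  theta-G⇒H : WalkTheta G → WalkTheta H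
  theta-G⇒H T with any? (v₀ ≟_) (vertices W₁) | any? (v₀ ≟_) (vertices W₂) | any? (v₀ ≟_) (vertices W₃)
    where open WalkTheta T
  ... | yes m | _     | _     = theta-inside T m
  ... | no _  | yes m | _     = theta-inside (swap₁₂ T) m
  ... | no _  | no _  | yes m = theta-inside (swap₁₃ T) m
  ... | no v₀∉W₁ | no v₀∉W₂ | no v₀∉W₃ with cover v₀ (λ { (inj₁ m) → v₀∉W₁ m ; (inj₂ (inj₁ m)) → v₀∉W₂ m
                                                          ; (inj₂ (inj₂ m)) → v₀∉W₃ m })
    where open PerfectMatchingAvoiding (WalkTheta.conformal T)
  ... | e , e-matched , e-at-v₀ with inc-v₀ e e-at-v₀
  ... | inj₁ refl = TC₁.V₀OffTheta.theta T v₀∉W₁ v₀∉W₂ v₀∉W₃ e-matched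
  ... | inj₂ refl = TC₂.V₀OffTheta.theta T v₀∉W₁ v₀∉W₂ v₀∉W₃ e-matched

  firstStep-swap : ∀ {u w} {W′ : Walk H u w} → CT₁.FirstStep W′ → CT₂.FirstStep W′
  firstStep-swap S = record
    { e′ = e′ ; s′ = s′ ; joins′ = joins′ ; B′ = B′ ; vertices-step = vertices-step ; edges-step = edges-step
    ; z = z ; f-z = f-z ; joins-z = joins-z }
    where open CT₁.FirstStep S

  theta-from-c : (T′ : WalkTheta H) → WalkTheta.a T′ ≡ c → WalkTheta G
  theta-from-c T′ a≡c = by-first-steps (CT₁.firstStep-special S₁ a≡c) (CT₁.firstStep-special S₂ a≡c)
                                       (CT₁.firstStep-special S₃ a≡c)
    where
    open WalkTheta T′
    S₁ : CT₁.FirstStep W₁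
    S₁ = CT₁.firstStep W₁ a≢b a≡c distinct₁
    S₂ : CT₁.FirstStep W₂
    S₂ = CT₁.firstStep W₂ a≢b a≡c distinct₂
    S₃ : CT₁.FirstStep W₃
    S₃ = CT₁.firstStep W₃ a≢b a≡c distinct₃
    open CT₁.FirstStep using (z)
    by-first-steps : z S₁ ≡ v₁ ⊎ z S₁ ≡ v₂ → z S₂ ≡ v₁ ⊎ z S₂ ≡ v₂ → z S₃ ≡ v₁ ⊎ z S₃ ≡ v₂ → WalkTheta G
    by-first-steps (inj₁ z₁) (inj₁ z₂) (inj₁ z₃) = CT₁.CEnd.theta-third-direct T′ a≡c S₁ S₂ S₃ z₁ z₂ z₃
    by-first-steps (inj₁ z₁) (inj₁ z₂) (inj₂ z₃) = CT₁.CEnd.theta-third-detour T′ a≡c S₁ S₂ S₃ z₁ z₂ z₃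
    by-first-steps (inj₁ z₁) (inj₂ z₂) (inj₁ z₃) = CT₁.CEnd.theta-third-detour (swap₂₃ T′) a≡c S₁ S₃ S₂ z₁ z₃ z₂
    by-first-steps (inj₂ z₁) (inj₁ z₂) (inj₁ z₃) = CT₁.CEnd.theta-third-detour (swap₁₃ T′) a≡c S₃ S₂ S₁ z₃ z₂ z₁
    by-first-steps (inj₂ z₁) (inj₂ z₂) (inj₂ z₃) =
      CT₂.CEnd.theta-third-direct T′ a≡c (firstStep-swap S₁) (firstStep-swap S₂) (firstStep-swap S₃) z₁ z₂ z₃
    by-first-steps (inj₂ z₁) (inj₂ z₂) (inj₁ z₃) =
      CT₂.CEnd.theta-third-detour T′ a≡c (firstStep-swap S₁) (firstStep-swap S₂) (firstStep-swap S₃) z₁ z₂ z₃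
    by-first-steps (inj₂ z₁) (inj₁ z₂) (inj₂ z₃) =
      CT₂.CEnd.theta-third-detour (swap₂₃ T′) a≡c (firstStep-swap S₁) (firstStep-swap S₃) (firstStep-swap S₂) z₁ z₃ z₂
    by-first-steps (inj₁ z₁) (inj₂ z₂) (inj₂ z₃) =
      CT₂.CEnd.theta-third-detour (swap₁₃ T′) a≡c (firstStep-swap S₃) (firstStep-swap S₂) (firstStep-swap S₁) z₃ z₂ z₁

  theta-through-c : (T′ : WalkTheta H) → c ∈ vertices (WalkTheta.W₁ T′) →
                    c ≢ WalkTheta.a T′ → c ≢ WalkTheta.b T′ → WalkTheta G
  theta-through-c T′ c∈ c≢a c≢b = through (splitAt c (WalkTheta.W₁ T′) c∈ c≢a c≢b)
    where
    through : SplitAt (WalkTheta.W₁ T′) c → WalkTheta G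
    through D′ with lift-edge-at-c joins⁻ (EH.joins⇒≢ joins⁻)
                  | lift-edge-at-c (EH.joins-sym joins⁺) (λ q → EH.joins⇒≢ joins⁺ (sym q))
      where open SplitAt D′
    ... | _ , J⁻ , inj₁ refl | _ , J⁺ , inj₁ refl = CT₁.CInside.ThroughV₁.theta T′ c≢a c≢b D′ J⁻ (joins-sym J⁺)
    ... | _ , J⁻ , inj₁ refl | _ , J⁺ , inj₂ refl = CT₁.CInside.ThroughV₀.theta T′ c≢a c≢b D′ J⁻ (joins-sym J⁺)
    ... | _ , J⁻ , inj₂ refl | _ , J⁺ , inj₂ refl = CT₂.CInside.ThroughV₁.theta T′ c≢a c≢b D′ J⁻ (joins-sym J⁺)
    ... | _ , J⁻ , inj₂ refl | _ , J⁺ , inj₁ refl = CT₂.CInside.ThroughV₀.theta T′ c≢a c≢b D′ J⁻ (joins-sym J⁺)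

  theta-at-c : (T′ : WalkTheta H) → OnWalks (WalkTheta.W₁ T′) (WalkTheta.W₂ T′) (WalkTheta.W₃ T′) c → WalkTheta G
  theta-at-c T′ c-on with c ≟ WalkTheta.a T′ | c ≟ WalkTheta.b T′
  ... | yes c≡a | _       = theta-from-c T′ (sym c≡a)
  ... | no _    | yes c≡b = theta-from-c (reverseTheta T′) (sym c≡b)
  ... | no c≢a  | no c≢b with c-on
  ... | inj₁ m        = theta-through-c T′ m c≢a c≢b
  ... | inj₂ (inj₁ m) = theta-through-c (swap₁₂ T′) m c≢a c≢b
  ... | inj₂ (inj₂ m) = theta-through-c (swap₁₃ T′) m c≢a c≢b

  theta-H⇒G : WalkTheta H → WalkTheta G
  theta-H⇒G T′ with any? (c ≟_) (vertices W₁) | any? (c ≟_) (vertices W₂) | any? (c ≟_) (vertices W₃)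
    where open WalkTheta T′
  ... | yes m | _     | _     = theta-at-c T′ (inj₁ m)
  ... | no _  | yes m | _     = theta-at-c T′ (inj₂ (inj₁ m))
  ... | no _  | no _  | yes m = theta-at-c T′ (inj₂ (inj₂ m))
  ... | no c∉W₁ | no c∉W₂ | no c∉W₃ with cover c (λ { (inj₁ m) → c∉W₁ m ; (inj₂ (inj₁ m)) → c∉W₂ m
                                                     ; (inj₂ (inj₂ m)) → c∉W₃ m })
    where open PerfectMatchingAvoiding (WalkTheta.conformal T′)
  ... | e′ , e′-matched , e′-at-c with inc-H⇒G e′-at-c
  ... | z , z-end , f-z with f≡c⇒special f-z
  ... | inj₁ refl        = ⊥-elim (g-avoids-v₀ e′ z-end)
  ... | inj₂ (inj₁ refl) = CT₁.COffTheta.theta T′ c∉W₁ c∉W₂ c∉W₃ e′ e′-matched z-end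
  ... | inj₂ (inj₂ refl) = CT₂.COffTheta.theta T′ c∉W₁ c∉W₂ c∉W₃ e′ e′-matched z-end

corollary47 : (G : Graph) → MatchingCovered G →
    (v₀ v₁ v₂ : V G) (e₁ e₂ : E G) → v₁ ≢ v₂ → DegreeTwo G v₀ v₁ v₂ e₁ e₂ →
    (H : Graph) → Contraction G v₀ v₁ v₂ e₁ e₂ H →
    (ThetaFree G ⇔ ThetaFree H)
corollary47 G _ v₀ v₁ v₂ e₁ e₂ v₁≢v₂ deg H C =
  mk⇔ (λ free-G T′ → free-G (walkTheta⇒theta (theta-H⇒G (theta⇒walkTheta T′))))
      (λ free-H T → free-H (walkTheta⇒theta (theta-G⇒H (theta⇒walkTheta T))))
  where open Equivalence G H v₀ v₁ v₂ e₁ e₂ v₁≢v₂ deg C
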